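{- The multiplication map $\mathrm{QSym}\otimes_{\mathbb{Q}}\mathbb{Q}[\mathbf x]\to\mathbb{Q}[[\mathbf x]]$, $g\otimes p\mapsto gp$, is injective and its image is exactly $\overleftarrow{QR}$; that is, $\overleftarrow{QR}=\mathrm{QSym}\otimes\mathbb{Q}[\mathbf x]$.
   Context: Variables $\mathbf{x}=\{x_i: i\in\mathbb{Z}\}$ and $\mathbf x_-=\{x_i: i\le 0\}$. $\mathbb{Q}[\mathbf x]$ is the polynomial ring in all $x_i$, $i\in\mathbb{Z}$. $\mathrm{QSym}$ is the algebra of quasisymmetric functions in $\mathbf x_-$: bounded-degree formal power series $f$ in $\mathbf x_-$ such that for every sequence of positive integers $(\alpha_1,\dots,\alpha_k)$, the coefficients of $x_{i_1}^{\alpha_1}\cdots x_{i_k}^{\alpha_k}$ and $x_{j_1}^{\alpha_1}\cdots x_{j_k}^{\alpha_k}$ agree whenever $i_1<\cdots<i_k\le 0$ and $j_1<\cdots<j_k\le 0$. Let $R\subseteq\mathbb{Q}[[\mathbf x]]$ be the set of bounded-degree formal power series in which, for some $N\in\mathbb{Z}$, no $x_i$ with $i>N$ appears. An $f\in R$ is back quasisymmetric if there is $b\in\mathbb{Z}$ such that for every sequence of positive integers $(a_1,\dots,a_k)$ and every monomial $\mathsf m$ in the variables $x_i$, $i>b$, the coefficient of $x_{i_1}^{a_1}\cdots x_{i_k}^{a_k}\mathsf m$ in $f$ equals that of $x_{j_1}^{a_1}\cdots x_{j_k}^{a_k}\mathsf m$ whenever $i_1<\cdots<i_k\le b$ and $j_1<\cdots<j_k\le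 b$. $\overleftarrow{QR}$ is the space of back quasisymmetric functions. -}

module Defs where

open import Data.Nat as ℕ using (ℕ; zero; suc)
open import Data.Integer as ℤ using (ℤ)
open import Data.Rational as ℚ using (ℚ; 0ℚ)
open import Data.List using (List; []; _∷_; _++_; replicate; length; map)
open import Data.List.Relation.Unary.Linked using (Linked)
open import Data.List.Relation.Unary.All using (All)
open import Data.List.Relation.Unary.Any using (Any)
open import Data.Vec using (Vec; []; _∷_; toList)
open import Data.Maybe using (Maybe; just; nothing)
open import Data.Product using (Σ; ∃; _×_; _,_; proj₁)
open import Relation.Nullary using (yes; no)
open import Relation.Binary.PropositionalEquality using (_≡_)

-- A monomial x_{i_1} x_{i_2} ⋯ x_{i_d} is represented by the list of its
-- variable indices (with repetition); the canonical representative is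
-- the weakly increasing list i_1 ≤ i_2 ≤ ⋯ ≤ i_d.

Monomial : Set
Monomial = List ℤ

SortedMon : Monomial → Set
SortedMon = Linked ℤ._≤_

-- Only the values on sorted (canonical) monomials are
-- meaningful; equality of series is equality of those coefficients.

Series : Set
Series = Monomial → ℚ

infix 4 _≈ˢ_
_≈ˢ_ : Series → Series → Set
f ≈ˢ g = ∀ m → SortedMon m → f m ≡ g m

0ˢ : Series
0ˢ _ = 0ℚ

_+ˢ_ : Series → Series → Series
(f +ˢ g) m = f m ℚ.+ g m

_•ˢ_ : ℚ → Series → Series
(c •ˢ f) m = c ℚ.* f m

BoundedDegree : Series → Set
BoundedDegree f = ∃ λ d → ∀ m → SortedMon m → d ℕ.< length m → f m ≡ 0ℚ

InR : Series → Set
InR f = BoundedDegree f ×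
        (∃ λ N → ∀ m → SortedMon m → Any (N ℤ.<_) m → f m ≡ 0ℚ)

-- x_{i_1}^{a_1+1} ⋯ x_{i_k}^{a_k+1}  (exponents are positive integers)

expand : ∀ {k} → Vec ℤ k → Vec ℕ k → Monomial
expand [] [] = []
expand (i ∷ is) (a ∷ as) = replicate (suc a) i ++ expand is as

StrictlyIncreasing : ∀ {k} → Vec ℤ k → Set
StrictlyIncreasing is = Linked ℤ._<_ (toList is)

IsQSym : Series → Set
IsQSym g =
  BoundedDegree g ×
  (∀ m → SortedMon m → Any (ℤ.0ℤ ℤ.<_) m → g m ≡ 0ℚ) ×
  (∀ k (as : Vec ℕ k) (is js : Vec ℤ k) →
     StrictlyIncreasing is → StrictlyIncreasing js →
     All (ℤ._≤ ℤ.0ℤ) (toList is) → All (ℤ._≤ ℤ.0ℤ) (toList js) →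
     g (expand is as) ≡ g (expand js as))

QSym : Set
QSym = Σ Series IsQSym

IsBackQuasisymmetric : Series → Set
IsBackQuasisymmetric f =
  ∃ λ b →
    ∀ k (as : Vec ℕ k) (is js : Vec ℤ k) →
      StrictlyIncreasing is → StrictlyIncreasing js →
      All (ℤ._≤ b) (toList is) → All (ℤ._≤ b) (toList js) →
      ∀ m → SortedMon m → All (b ℤ.<_) m →
      f (expand is as ++ m) ≡ f (expand js as ++ m)

InBackQR : Series → Set
InBackQR f = InR f × IsBackQuasisymmetric f

-- Polynomials ℚ[𝐱]: formal finite ℚ-linear combinations of monomials
-- (a monomial in a term may be listed in any order).

Poly : Set
Poly = List (ℚ × Monomial)

_+ᵖ_ : Poly → Poly → Poly
p +ᵖ q = p ++ q

_•ᵖ_ : ℚ → Poly → Poly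
c •ᵖ p = map (λ { (a , u) → (c ℚ.* a , u) }) p

remove : ℤ → List ℤ → Maybe (List ℤ)
remove i [] = nothing
remove i (j ∷ js) with i ℤ.≟ j
... | yes _ = just js
... | no _ with remove i js
...   | just r = just (j ∷ r)
...   | nothing = nothing

monus : Monomial → Monomial → Maybe Monomial
monus m [] = just m
monus m (u ∷ us) with remove u m
... | just r = monus r us
... | nothing = nothing

coeffᵖ : Poly → Series
coeffᵖ [] m = 0ℚ
coeffᵖ ((c , u) ∷ p) m with monus m u
... | just [] = c ℚ.+ coeffᵖ p m
... | _ = coeffᵖ p m

_≈ᵖ_ : Poly → Poly → Set
p ≈ᵖ q = coeffᵖ p ≈ˢ coeffᵖ q

_·ᵖ_ : Series → Poly → Series
(g ·ᵖ []) m = 0ℚ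
(g ·ᵖ ((c , u) ∷ p)) m with monus m u
... | just r = c ℚ.* g r ℚ.+ (g ·ᵖ p) m
... | nothing = (g ·ᵖ p) m

-- The tensor product QSym ⊗_ℚ ℚ[𝐱]: finite formal sums of pure tensors
-- g ⊗ p (lists, with _++_ as addition), modulo the congruence generated by
-- commutativity of + and ℚ-bilinearity.

Tensor : Set
Tensor = List (QSym × Poly)

infix 4 _∼_
data _∼_ : Tensor → Tensor → Set where
  ∼-refl  : ∀ {t} → t ∼ t
  ∼-sym   : ∀ {t t'} → t ∼ t' → t' ∼ t
  ∼-trans : ∀ {t t' t''} → t ∼ t' → t' ∼ t'' → t ∼ t''
  ∼-++    : ∀ {t₁ t₁' t₂ t₂'} → t₁ ∼ t₁' → t₂ ∼ t₂' → t₁ ++ t₂ ∼ t₁' ++ t₂'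
  ∼-comm  : ∀ t₁ t₂ → t₁ ++ t₂ ∼ t₂ ++ t₁
  ∼-elt   : ∀ (g g' : QSym) {p p'} → proj₁ g ≈ˢ proj₁ g' → p ≈ᵖ p' →
            (g , p) ∷ [] ∼ (g' , p') ∷ []
  ∼-addL  : ∀ (g g₁ g₂ : QSym) p → proj₁ g ≈ˢ proj₁ g₁ +ˢ proj₁ g₂ →
            (g , p) ∷ [] ∼ (g₁ , p) ∷ (g₂ , p) ∷ []
  ∼-addR  : ∀ (g : QSym) p₁ p₂ →
            (g , p₁ +ᵖ p₂) ∷ [] ∼ (g , p₁) ∷ (g , p₂) ∷ []
  ∼-smul  : ∀ (c : ℚ) (g g' : QSym) p → proj₁ g' ≈ˢ c •ˢ proj₁ g →
            (g' , p) ∷ [] ∼ (g , c •ᵖ p) ∷ []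
  ∼-zero  : ∀ (g : QSym) p → proj₁ g ≈ˢ 0ˢ → (g , p) ∷ [] ∼ []

mult : Tensor → Series
mult [] = 0ˢ
mult ((g , p) ∷ t) = (proj₁ g ·ᵖ p) +ˢ mult t

-- Injectivity: every tensor is equivalent to a sum Σ h_v ⊗ x^v over distinct sorted monomials v. If its
-- image vanishes, take L below every variable that occurs; once all h_w with w shorter than v are known to
-- vanish, the coefficient of x^s x^v for s supported left of L is h_v(s), and a quasisymmetric function
-- vanishing on all monomials far to the left is zero.
--
-- Surjectivity: induction on the degree of f ∈ QR←, then on the threshold -p of back quasisymmetry, then on
-- the largest variable x_q. Write f = Σ_a x_c^a f_a according to the exponent of x_c; the pieces with a > 0
-- have smaller degree. At threshold 0 take c = q, so that f_0 lives in fewer variables. At threshold -p-1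
-- take c = -p: the shift x_i ↦ x_{i-1} (i ≤ c) of f is back quasisymmetric at -p, and the difference of f
-- and its shift has f_0 = 0. At threshold 0 with q = 0, f itself lies in QSym.

module Submission where

open import Defs
open import Data.Nat as ℕ using (ℕ; zero; suc)
import Data.Nat.Properties as ℕP
open import Data.Nat.Induction using (<-rec)
open import Data.Integer as ℤ using (ℤ)
import Data.Integer.Properties as ℤP
open import Data.Rational as ℚ using (ℚ; 0ℚ; 1ℚ)
import Data.Rational.Properties as ℚP
open import Data.Rational.Solver using (module +-*-Solver)
open import Algebra.Bundles using (CommutativeMonoid)
open import Algebra.Properties.CommutativeSemigroup (CommutativeMonoid.commutativeSemigroup ℚP.+-0-commutativeMonoid)
  using (x∙yz≈y∙xz; xy∙z≈y∙xz)
open import Data.List using (List; []; _∷_; _++_; length; map; replicate; filter; foldr; concat)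
import Data.List.Properties as ListP
open import Data.List.Relation.Unary.Linked as Linked using (Linked; []; [-]; _∷_)
open import Data.List.Relation.Unary.Linked.Properties as LinkedP using (Linked⇒AllPairs; AllPairs⇒Linked)
open import Data.List.Relation.Unary.AllPairs using (AllPairs; []; _∷_)
import Data.List.Relation.Unary.AllPairs.Properties as AllPairsP
open import Data.List.Relation.Unary.All as All using (All; []; _∷_)
import Data.List.Relation.Unary.All.Properties as AllP
open import Data.List.Relation.Unary.Any as Any using (Any; here; there)
import Data.List.Relation.Unary.Any.Properties as AnyP
open import Data.List.Membership.Propositional using (_∈_; _∉_; find; lose)
open import Data.List.Membership.Propositional.Properties using (∈-++⁺ʳ; ∈-map⁺; ∈-filter⁺)
open import Data.List.Relation.Binary.Permutation.Propositional using (_↭_; refl; prep; swap; trans)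
open import Data.List.Sort ℤP.≤-decTotalOrder using (sort; sort-↭; sort-↗)
open import Data.Vec as Vec using (Vec; []; _∷_; toList)
import Data.Vec.Properties as VecP
open import Data.Maybe as Maybe using (Maybe; just; nothing; _>>=_)
open import Data.Product using (∃; _×_; _,_; proj₁; proj₂)
open import Data.Empty using (⊥-elim)
open import Function.Base using (_∘_)
open import Function.Bundles using (_⇔_; mk⇔)
open import Relation.Binary.Core using (Rel)
open import Relation.Binary.Definitions using (Transitive; tri<; tri≈; tri>)
open import Relation.Nullary using (Dec; yes; no; ¬_)
open import Relation.Binary.PropositionalEquality as ≡ using (_≡_; _≢_; refl; sym; cong; cong₂; subst)

module _ {a ℓ} {A : Set a} {R : Rel A ℓ} where

  Linked-++⁻ˡ : ∀ xs {ys} → Linked R (xs ++ ys) → Linked R xs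
  Linked-++⁻ˡ [] _ = []
  Linked-++⁻ˡ (x ∷ []) _ = [-]
  Linked-++⁻ˡ (x ∷ y ∷ xs) (r ∷ l) = r ∷ Linked-++⁻ˡ (y ∷ xs) l

  Linked-++⁻ʳ : ∀ xs {ys} → Linked R (xs ++ ys) → Linked R ys
  Linked-++⁻ʳ [] l = l
  Linked-++⁻ʳ (x ∷ xs) l = Linked-++⁻ʳ xs (Linked.tail l)

module LinkedTransitive {a ℓ} {A : Set a} {R : Rel A ℓ} (R-trans : Transitive R) where

  head-All : ∀ {x xs} → Linked R (x ∷ xs) → All (R x) xs
  head-All l with Linked⇒AllPairs R-trans l
  ... | Rx ∷ _ = Rx

  ∷⁺ : ∀ {x xs} → All (R x) xs → Linked R xs → Linked R (x ∷ xs)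
  ∷⁺ [] [] = [-]
  ∷⁺ (Rxy ∷ _) l = Rxy ∷ l

  ++⁺ : ∀ {xs ys} → Linked R xs → Linked R ys →
        All (λ x → All (R x) ys) xs → Linked R (xs ++ ys)
  ++⁺ lx ly sep =
    AllPairs⇒Linked (AllPairsP.++⁺ (Linked⇒AllPairs R-trans lx) (Linked⇒AllPairs R-trans ly) sep)

module ≤-Linked = LinkedTransitive {R = ℤ._≤_} ℤP.≤-trans
module <-Linked = LinkedTransitive {R = ℤ._<_} ℤP.<-trans

StrictlySorted : List ℤ → Set
StrictlySorted = Linked ℤ._<_

separated-≤ : ∀ {b xs ys} → All (ℤ._≤ b) xs → All (b ℤ.<_) ys → All (λ x → All (x ℤ.≤_) ys) xs
separated-≤ xb yb = All.map (λ x≤b → All.map (λ b<y → ℤP.<⇒≤ (ℤP.≤-<-trans x≤b b<y)) yb) xb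

separated-< : ∀ {b xs ys} → All (ℤ._≤ b) xs → All (b ℤ.<_) ys → All (λ x → All (x ℤ.<_) ys) xs
separated-< xb yb = All.map (λ x≤b → All.map (ℤP.≤-<-trans x≤b) yb) xb

sorted-++-separated : ∀ {b xs ys} → SortedMon xs → SortedMon ys →
                      All (ℤ._≤ b) xs → All (b ℤ.<_) ys → SortedMon (xs ++ ys)
sorted-++-separated sx sy xb yb = ≤-Linked.++⁺ sx sy (separated-≤ xb yb)

replicate-sorted : ∀ n c → SortedMon (replicate n c)
replicate-sorted zero c = []
replicate-sorted (suc zero) c = [-]
replicate-sorted (suc (suc n)) c = ℤP.≤-refl ∷ replicate-sorted (suc n) c

All-<⇒∉ : ∀ {c xs} → All (ℤ._< c) xs → c ∉ xs
All-<⇒∉ xs<c c∈xs = ℤP.<-irrefl refl (All.lookup xs<c c∈xs)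

All->⇒∉ : ∀ {c xs} → All (c ℤ.<_) xs → c ∉ xs
All->⇒∉ c<xs c∈xs = ℤP.<-irrefl refl (All.lookup c<xs c∈xs)

nonpositive : ∀ m → ¬ Any (ℤ.0ℤ ℤ.<_) m → All (ℤ._≤ ℤ.0ℤ) m
nonpositive m ¬pos = All.tabulate (λ j∈m → ℤP.≮⇒≥ (λ 0<j → ¬pos (lose j∈m 0<j)))

lowerBound : List ℤ → ℤ
lowerBound = foldr ℤ._⊓_ ℤ.0ℤ

lowerBound-≤ : ∀ xs → All (lowerBound xs ℤ.≤_) xs
lowerBound-≤ [] = []
lowerBound-≤ (x ∷ xs) =
  ℤP.i⊓j≤i x (lowerBound xs) ∷ All.map (ℤP.≤-trans (ℤP.i⊓j≤j x (lowerBound xs))) (lowerBound-≤ xs)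

upperBound : List ℤ → ℤ
upperBound = foldr ℤ._⊔_ ℤ.0ℤ

upperBound-≥ : ∀ xs → All (ℤ._≤ upperBound xs) xs
upperBound-≥ [] = []
upperBound-≥ (x ∷ xs) =
  ℤP.i≤i⊔j x (upperBound xs) ∷ All.map (λ y≤ → ℤP.≤-trans y≤ (ℤP.i≤j⊔i x (upperBound xs))) (upperBound-≥ xs)

0≤upperBound : ∀ xs → ℤ.0ℤ ℤ.≤ upperBound xs
0≤upperBound [] = ℤP.≤-refl
0≤upperBound (x ∷ xs) = ℤP.≤-trans (0≤upperBound xs) (ℤP.i≤j⊔i x (upperBound xs))

farLeftOf : ℤ → ℤ
farLeftOf L = ℤ.-[1+ ℤ.∣ L ∣ ]

farLeftOf-< : ∀ L → farLeftOf L ℤ.< L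
farLeftOf-< (ℤ.+ n) = ℤ.-<+
farLeftOf-< ℤ.-[1+ n ] = ℤ.-<- (ℕP.n<1+n n)

farLeftOf-<0 : ∀ L → farLeftOf L ℤ.< ℤ.0ℤ
farLeftOf-<0 L = ℤ.-<+

remove⇒∈ : ∀ i xs {r} → remove i xs ≡ just r → i ∈ xs
remove⇒∈ i [] ()
remove⇒∈ i (j ∷ js) eq with i ℤ.≟ j
... | yes i≡j = here i≡j
... | no _ with remove i js in e
...   | just _ = there (remove⇒∈ i js e)
remove⇒∈ i (j ∷ js) () | no _ | nothing

remove-length : ∀ i xs {r} → remove i xs ≡ just r → length xs ≡ suc (length r)
remove-length i [] ()
remove-length i (j ∷ js) eq with i ℤ.≟ j
remove-length i (j ∷ js) refl | yes _ = refl
... | no _ with remove i js in e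
remove-length i (j ∷ js) refl | no _ | just _ = cong suc (remove-length i js e)
remove-length i (j ∷ js) () | no _ | nothing

remove-All : ∀ {P : ℤ → Set} i xs {r} → All P xs → remove i xs ≡ just r → All P r
remove-All i [] _ ()
remove-All i (j ∷ js) (p ∷ ps) eq with i ℤ.≟ j
remove-All i (j ∷ js) (p ∷ ps) refl | yes _ = ps
... | no _ with remove i js in e
remove-All i (j ∷ js) (p ∷ ps) refl | no _ | just _ = p ∷ remove-All i js ps e
remove-All i (j ∷ js) (p ∷ ps) () | no _ | nothing

remove-sorted : ∀ i xs {r} → SortedMon xs → remove i xs ≡ just r → SortedMon r
remove-sorted i [] _ ()
remove-sorted i (j ∷ js) s eq with i ℤ.≟ j
remove-sorted i (j ∷ js) s refl | yes _ = Linked.tail s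
... | no _ with remove i js in e
remove-sorted i (j ∷ js) s refl | no _ | just _ =
  ≤-Linked.∷⁺ (remove-All i js (≤-Linked.head-All s) e) (remove-sorted i js (Linked.tail s) e)
remove-sorted i (j ∷ js) s () | no _ | nothing

remove-∈⁺ : ∀ i xs {r j} → remove i xs ≡ just r → j ∈ xs → j ≢ i → j ∈ r
remove-∈⁺ i [] ()
remove-∈⁺ i (k ∷ ks) eq j∈ j≢i with i ℤ.≟ k
remove-∈⁺ i (k ∷ ks) refl (here refl) j≢i | yes i≡k = ⊥-elim (j≢i (sym i≡k))
remove-∈⁺ i (k ∷ ks) refl (there j∈) j≢i | yes _ = j∈
... | no _ with remove i ks in e
remove-∈⁺ i (k ∷ ks) refl (here refl) j≢i | no _ | just _ = here refl
remove-∈⁺ i (k ∷ ks) refl (there j∈) j≢i | no _ | just _ = there (remove-∈⁺ i ks e j∈ j≢i)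
remove-∈⁺ i (k ∷ ks) () j∈ j≢i | no _ | nothing

remove-here : ∀ i js → remove i (i ∷ js) ≡ just js
remove-here i js with i ℤ.≟ i
... | yes _ = refl
... | no i≢i = ⊥-elim (i≢i refl)

remove-there : ∀ i j js → i ≢ j → remove i (j ∷ js) ≡ Maybe.map (j ∷_) (remove i js)
remove-there i j js i≢j with i ℤ.≟ j
... | yes i≡j = ⊥-elim (i≢j i≡j)
... | no _ with remove i js
...   | just _ = refl
...   | nothing = refl

remove-∉ : ∀ i xs → i ∉ xs → remove i xs ≡ nothing
remove-∉ i [] _ = refl
remove-∉ i (j ∷ js) i∉ with i ℤ.≟ j
... | yes i≡j = ⊥-elim (i∉ (here i≡j))
... | no _ rewrite remove-∉ i js (i∉ ∘ there) = refl

remove-++ˡ : ∀ i s xs → i ∉ s → remove i (s ++ xs) ≡ Maybe.map (s ++_) (remove i xs)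
remove-++ˡ i [] xs _ with remove i xs
... | just _ = refl
... | nothing = refl
remove-++ˡ i (j ∷ s) xs i∉ with i ℤ.≟ j
... | yes i≡j = ⊥-elim (i∉ (here i≡j))
... | no _ rewrite remove-++ˡ i s xs (λ i∈s → i∉ (there i∈s)) with remove i xs
...   | just _ = refl
...   | nothing = refl

remove-minimum : ∀ u xs {r} → SortedMon xs → remove u xs ≡ just r → All (u ℤ.≤_) r → xs ≡ u ∷ r
remove-minimum u [] _ ()
remove-minimum u (j ∷ js) s eq u≤r with u ℤ.≟ j
remove-minimum u (j ∷ js) s refl u≤r | yes u≡j = cong (_∷ js) (sym u≡j)
... | no u≢j with remove u js in e
remove-minimum u (j ∷ js) s refl (u≤j ∷ _) | no u≢j | just _ =
  ⊥-elim (u≢j (ℤP.≤-antisym u≤j (All.lookup (≤-Linked.head-All s) (remove⇒∈ u js e))))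
remove-minimum u (j ∷ js) s () u≤r | no u≢j | nothing

remove-comm : ∀ x y m → (remove y m >>= remove x) ≡ (remove x m >>= remove y)
remove-comm x y m with x ℤ.≟ y
... | yes refl = refl
remove-comm x y [] | no x≢y = refl
remove-comm x y (j ∷ js) | no x≢y = by-cases (x ℤ.≟ j) (y ℤ.≟ j)
  where
  remove-map-∷ : ∀ z (mr : Maybe (List ℤ)) → z ≢ j →
                 (Maybe.map (j ∷_) mr >>= remove z) ≡ Maybe.map (j ∷_) (mr >>= remove z)
  remove-map-∷ z (just r) z≢j = remove-there z j r z≢j
  remove-map-∷ z nothing z≢j = refl

  by-cases : Dec (x ≡ j) → Dec (y ≡ j) →
             (remove y (j ∷ js) >>= remove x) ≡ (remove x (j ∷ js) >>= remove y)
  by-cases (yes refl) (yes refl) = ⊥-elim (x≢y refl)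
  by-cases (yes refl) (no y≢j) rewrite remove-there y x js y≢j | remove-here x js with remove y js
  ... | just r = remove-here x r
  ... | nothing = refl
  by-cases (no x≢j) (yes refl) rewrite remove-there x y js x≢j | remove-here y js with remove x js
  ... | just r = sym (remove-here y r)
  ... | nothing = refl
  by-cases (no x≢j) (no y≢j) rewrite remove-there x j js x≢j | remove-there y j js y≢j =
    ≡.trans (remove-map-∷ x (remove y js) x≢j)
      (≡.trans (cong (Maybe.map (j ∷_)) (remove-comm x y js)) (sym (remove-map-∷ y (remove x js) y≢j)))

monus-∷ : ∀ m u us → monus m (u ∷ us) ≡ (remove u m >>= λ r → monus r us)
monus-∷ m u us with remove u m
... | just _ = refl
... | nothing = refl

monus-length : ∀ m u {r} → monus m u ≡ just r → length m ≡ length u ℕ.+ length r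
monus-length m [] refl = refl
monus-length m (u ∷ us) eq with remove u m in e
... | just r = ≡.trans (remove-length u m e) (cong suc (monus-length r us eq))
monus-length m (u ∷ us) () | nothing

monus-All : ∀ {P : ℤ → Set} m u {r} → All P m → monus m u ≡ just r → All P r
monus-All m [] Pm refl = Pm
monus-All m (u ∷ us) Pm eq with remove u m in e
... | just r = monus-All r us (remove-All u m Pm e) eq
monus-All m (u ∷ us) Pm () | nothing

monus-sorted : ∀ m u {r} → SortedMon m → monus m u ≡ just r → SortedMon r
monus-sorted m [] sm refl = sm
monus-sorted m (u ∷ us) sm eq with remove u m in e
... | just r = monus-sorted r us (remove-sorted u m sm e) eq
monus-sorted m (u ∷ us) sm () | nothing

monus-∈⁺ : ∀ m u {r j} → monus m u ≡ just r → j ∈ m → j ∉ u → j ∈ r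
monus-∈⁺ m [] refl j∈m _ = j∈m
monus-∈⁺ m (u ∷ us) eq j∈m j∉u with remove u m in e
... | just r = monus-∈⁺ r us eq (remove-∈⁺ u m e j∈m (j∉u ∘ here)) (j∉u ∘ there)
monus-∈⁺ m (u ∷ us) () j∈m j∉u | nothing

Disjoint : List ℤ → List ℤ → Set
Disjoint u s = ∀ {i} → i ∈ u → i ∉ s

monus-++ˡ : ∀ s m u → Disjoint u s → monus (s ++ m) u ≡ Maybe.map (s ++_) (monus m u)
monus-++ˡ s m [] _ = refl
monus-++ˡ s m (u ∷ us) disj rewrite remove-++ˡ u s m (disj (here refl)) with remove u m
... | just r = monus-++ˡ s r us (disj ∘ there)
... | nothing = refl

monus-++ʳ : ∀ m u v → monus m (u ++ v) ≡ (monus m u >>= λ r → monus r v)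
monus-++ʳ m [] v = refl
monus-++ʳ m (u ∷ us) v with remove u m
... | just r = monus-++ʳ r us v
... | nothing = refl

>>=-assoc : ∀ {A B C : Set} (a : Maybe A) (f : A → Maybe B) (g : B → Maybe C) →
            ((a >>= f) >>= g) ≡ (a >>= λ x → f x >>= g)
>>=-assoc (just x) f g = refl
>>=-assoc nothing f g = refl

>>=-cong : ∀ {A B : Set} (a : Maybe A) {f g : A → Maybe B} → (∀ x → f x ≡ g x) → (a >>= f) ≡ (a >>= g)
>>=-cong (just x) f≗g = f≗g x
>>=-cong nothing f≗g = refl

monus-↭ : ∀ {u u'} → u ↭ u' → ∀ m → monus m u ≡ monus m u'
monus-↭ refl m = refl
monus-↭ (prep x p) m =
  ≡.trans (monus-∷ m x _) (≡.trans (>>=-cong (remove x m) (monus-↭ p)) (sym (monus-∷ m x _)))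
monus-↭ (swap {xs} {ys} x y p) m = begin
  monus m (x ∷ y ∷ xs)
    ≡⟨ monus-∷ m x (y ∷ xs) ⟩
  (remove x m >>= λ r → monus r (y ∷ xs))
    ≡⟨ >>=-cong (remove x m) (λ r → ≡.trans (monus-∷ r y xs) (>>=-cong (remove y r) (monus-↭ p))) ⟩
  (remove x m >>= λ r → remove y r >>= λ r' → monus r' ys)
    ≡⟨ sym (>>=-assoc (remove x m) (remove y) (λ r → monus r ys)) ⟩
  ((remove x m >>= remove y) >>= λ r → monus r ys)
    ≡⟨ cong (_>>= λ r → monus r ys) (remove-comm y x m) ⟩
  ((remove y m >>= remove x) >>= λ r → monus r ys)
    ≡⟨ >>=-assoc (remove y m) (remove x) (λ r → monus r ys) ⟩
  (remove y m >>= λ r → remove x r >>= λ r' → monus r' ys)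
    ≡⟨ >>=-cong (remove y m) (λ r → sym (monus-∷ r x ys)) ⟩
  (remove y m >>= λ r → monus r (x ∷ ys))
    ≡⟨ sym (monus-∷ m y (x ∷ ys)) ⟩
  monus m (y ∷ x ∷ ys) ∎
  where open ≡.≡-Reasoning
monus-↭ (trans p q) m = ≡.trans (monus-↭ p m) (monus-↭ q m)

monus-self : ∀ m → monus m m ≡ just []
monus-self [] = refl
monus-self (x ∷ xs) rewrite monus-∷ (x ∷ xs) x xs | remove-here x xs = monus-self xs

monus≡just[]⇒≡ : ∀ m u → SortedMon m → SortedMon u → monus m u ≡ just [] → m ≡ u
monus≡just[]⇒≡ m [] sm su refl = refl
monus≡just[]⇒≡ m (u ∷ us) sm su eq with remove u m in e
... | just r with monus≡just[]⇒≡ r us (remove-sorted u m sm e) (Linked.tail su) eq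
...   | refl = remove-minimum u m sm e (≤-Linked.head-All su)
monus≡just[]⇒≡ m (u ∷ us) sm su () | nothing

expand-All : ∀ {P : ℤ → Set} {k} (is : Vec ℤ k) (as : Vec ℕ k) → All P (toList is) → All P (expand is as)
expand-All [] [] _ = []
expand-All (i ∷ is) (a ∷ as) (p ∷ ps) = AllP.++⁺ (AllP.replicate⁺ (suc a) p) (expand-All is as ps)

expand-sorted : ∀ {k} (is : Vec ℤ k) (as : Vec ℕ k) → StrictlySorted (toList is) → SortedMon (expand is as)
expand-sorted [] [] _ = []
expand-sorted (i ∷ is) (a ∷ as) si =
  sorted-++-separated (replicate-sorted (suc a) i) (expand-sorted is as (Linked.tail si))
    (AllP.replicate⁺ (suc a) ℤP.≤-refl) (expand-All is as (<-Linked.head-All si))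

expand-++ : ∀ {k l} (is : Vec ℤ k) (as : Vec ℕ k) (is' : Vec ℤ l) (as' : Vec ℕ l) →
            expand (is Vec.++ is') (as Vec.++ as') ≡ expand is as ++ expand is' as'
expand-++ [] [] is' as' = refl
expand-++ (i ∷ is) (a ∷ as) is' as' =
  ≡.trans (cong (replicate (suc a) i ++_) (expand-++ is as is' as'))
          (sym (ListP.++-assoc (replicate (suc a) i) _ _))

expand-map : ∀ (f : ℤ → ℤ) {k} (is : Vec ℤ k) (as : Vec ℕ k) → map f (expand is as) ≡ expand (Vec.map f is) as
expand-map f [] [] = refl
expand-map f (i ∷ is) (a ∷ as) =
  ≡.trans (ListP.map-++ f (replicate (suc a) i) _) (cong₂ _++_ (ListP.map-replicate f (suc a) i) (expand-map f is as))

strictlySorted-map : ∀ (f : ℤ → ℤ) → (∀ {x y} → x ℤ.< y → f x ℤ.< f y) →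
                     ∀ {k} (is : Vec ℤ k) → StrictlySorted (toList is) → StrictlySorted (toList (Vec.map f is))
strictlySorted-map f f-mono is si =
  subst StrictlySorted (sym (VecP.toList-map f is)) (LinkedP.map⁺ {R = ℤ._<_} {f = f} (Linked.map f-mono si))

All-toList-map : ∀ {P Q : ℤ → Set} (f : ℤ → ℤ) → (∀ {x} → P x → Q (f x)) →
          ∀ {k} (is : Vec ℤ k) → All P (toList is) → All Q (toList (Vec.map f is))
All-toList-map f P⇒Qf [] [] = []
All-toList-map f P⇒Qf (i ∷ is) (p ∷ ps) = P⇒Qf p ∷ All-toList-map f P⇒Qf is ps

record ExponentVector (s : List ℤ) : Set where
  constructor mkExponentVector
  field
    {k} : ℕ
    is : Vec ℤ k
    as : Vec ℕ k
    increasing : StrictlySorted (toList is)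
    expand≡ : expand is as ≡ s
    ⊆ : ∀ {j} → j ∈ toList is → j ∈ s

  All⁺ : ∀ {P : ℤ → Set} → All P s → All P (toList is)
  All⁺ Ps = All.tabulate (λ j∈ → All.lookup Ps (⊆ j∈))

record ExponentVector⁺ (x : ℤ) (s : List ℤ) : Set where
  constructor mkExponentVector⁺
  field
    {k} : ℕ
    a : ℕ
    is : Vec ℤ k
    as : Vec ℕ k
    increasing : StrictlySorted (x ∷ toList is)
    expand≡ : expand (x ∷ is) (a ∷ as) ≡ x ∷ s
    ⊆ : ∀ {j} → j ∈ toList is → j ∈ s

exponentVector⁺ : ∀ x s → SortedMon (x ∷ s) → ExponentVector⁺ x s
exponentVector⁺ x [] _ = mkExponentVector⁺ 0 [] [] [-] refl (λ ())
exponentVector⁺ x (y ∷ s) (x≤y ∷ sy) with exponentVector⁺ y s sy | x ℤ.≟ y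
... | mkExponentVector⁺ a is as inc eq ⊆ | yes refl =
  mkExponentVector⁺ (suc a) is as inc (cong (x ∷_) eq) (there ∘ ⊆)
... | mkExponentVector⁺ a is as inc eq ⊆ | no x≢y =
  mkExponentVector⁺ 0 (y ∷ is) (a ∷ as) (ℤP.≤∧≢⇒< x≤y x≢y ∷ inc) (cong (x ∷_) eq)
    λ { (here j≡y) → here j≡y ; (there j∈) → there (⊆ j∈) }

exponentVector : ∀ s → SortedMon s → ExponentVector s
exponentVector [] _ = mkExponentVector [] [] [] refl (λ ())
exponentVector (x ∷ s) sx with exponentVector⁺ x s sx
... | mkExponentVector⁺ a is as inc eq ⊆ =
  mkExponentVector (x ∷ is) (a ∷ as) inc eq λ { (here j≡x) → here j≡x ; (there j∈) → there (⊆ j∈) }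

SplitAt : ℤ → List ℤ → Set
SplitAt b w = ∃ λ ((s , m) : List ℤ × List ℤ) → w ≡ s ++ m × All (ℤ._≤ b) s × All (b ℤ.<_) m

splitAt : ∀ b w → SortedMon w → SplitAt b w
splitAt b [] _ = ([] , []) , refl , [] , []
splitAt b (x ∷ w) sw with x ℤ.≤? b
... | no x≰b = ([] , x ∷ w) , refl , [] , b<x ∷ All.map (ℤP.<-≤-trans b<x) (≤-Linked.head-All sw)
  where
  b<x : b ℤ.< x
  b<x = ℤP.≰⇒> x≰b
... | yes x≤b with splitAt b w (Linked.tail sw)
...   | (s , m) , eq , s≤b , b<m = (x ∷ s , m) , cong (x ∷_) eq , x≤b ∷ s≤b , b<m

DegreeAtMost : ℕ → Series → Set
DegreeAtMost d f = ∀ m → SortedMon m → d ℕ.< length m → f m ≡ 0ℚ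

VanishesAbove : ℤ → Series → Set
VanishesAbove N f = ∀ m → SortedMon m → Any (N ℤ.<_) m → f m ≡ 0ℚ

BackQuasisymmetricAt : ℤ → Series → Set
BackQuasisymmetricAt b f =
  ∀ k (as : Vec ℕ k) (is js : Vec ℤ k) →
    StrictlyIncreasing is → StrictlyIncreasing js →
    All (ℤ._≤ b) (toList is) → All (ℤ._≤ b) (toList js) →
    ∀ m → SortedMon m → All (b ℤ.<_) m →
    f (expand is as ++ m) ≡ f (expand js as ++ m)

expand-++-sorted : ∀ b {k} (is : Vec ℤ k) (as : Vec ℕ k) {m} → StrictlyIncreasing is → All (ℤ._≤ b) (toList is) →
                   SortedMon m → All (b ℤ.<_) m → SortedMon (expand is as ++ m)
expand-++-sorted b is as si is≤b sm b<m =
  sorted-++-separated (expand-sorted is as si) sm (expand-All is as is≤b) b<m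

-- A sorted m₁ with b < m₁ ≤ c is absorbed into exponent vectors bounded by b, giving ones bounded by c.
module AbsorbPrefix {b c} (b≤c : b ℤ.≤ c) (m₁ : List ℤ) (sm₁ : SortedMon m₁)
                    (b<m₁ : All (b ℤ.<_) m₁) (m₁≤c : All (ℤ._≤ c) m₁) where

  private module E = ExponentVector (exponentVector m₁ sm₁)

  is₁ : Vec ℤ E.k
  is₁ = E.is

  as₁ : Vec ℕ E.k
  as₁ = E.as

  expand-absorb : ∀ {k} (xs : Vec ℤ k) (as : Vec ℕ k) → expand (xs Vec.++ is₁) (as Vec.++ as₁) ≡ expand xs as ++ m₁
  expand-absorb xs as = ≡.trans (expand-++ xs as is₁ as₁) (cong (expand xs as ++_) E.expand≡)

  absorb-increasing : ∀ {k} (xs : Vec ℤ k) → StrictlyIncreasing xs → All (ℤ._≤ b) (toList xs) →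
                      StrictlyIncreasing (xs Vec.++ is₁)
  absorb-increasing xs sx xs≤b =
    subst StrictlySorted (sym (VecP.toList-++ xs is₁)) (<-Linked.++⁺ sx E.increasing (separated-< xs≤b (E.All⁺ b<m₁)))

  absorb-≤ : ∀ {k} (xs : Vec ℤ k) → All (ℤ._≤ b) (toList xs) → All (ℤ._≤ c) (toList (xs Vec.++ is₁))
  absorb-≤ xs xs≤b = subst (All (ℤ._≤ c)) (sym (VecP.toList-++ xs is₁))
                       (AllP.++⁺ (All.map (λ x≤b → ℤP.≤-trans x≤b b≤c) xs≤b) (E.All⁺ m₁≤c))

backQuasisymmetricAt-mono : ∀ {b c F} → b ℤ.≤ c → BackQuasisymmetricAt c F → BackQuasisymmetricAt b F
backQuasisymmetricAt-mono {b} {c} {F} b≤c bq k as is js si sj is≤b js≤b m sm b<m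
  with splitAt c m sm
... | (m₁ , m₂) , refl , m₁≤c , c<m₂ = begin
  F (expand is as ++ m₁ ++ m₂)                         ≡⟨ cong F (sym (ListP.++-assoc (expand is as) m₁ m₂)) ⟩
  F ((expand is as ++ m₁) ++ m₂)                       ≡⟨ cong (λ w → F (w ++ m₂)) (sym (expand-absorb is as)) ⟩
  F (expand (is Vec.++ is₁) (as Vec.++ as₁) ++ m₂)
    ≡⟨ bq _ (as Vec.++ as₁) (is Vec.++ is₁) (js Vec.++ is₁) (absorb-increasing is si is≤b) (absorb-increasing js sj js≤b)
          (absorb-≤ is is≤b) (absorb-≤ js js≤b) m₂ (Linked-++⁻ʳ m₁ sm) c<m₂ ⟩
  F (expand (js Vec.++ is₁) (as Vec.++ as₁) ++ m₂)     ≡⟨ cong (λ w → F (w ++ m₂)) (expand-absorb js as) ⟩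
  F ((expand js as ++ m₁) ++ m₂)                       ≡⟨ cong F (ListP.++-assoc (expand js as) m₁ m₂) ⟩
  F (expand js as ++ m₁ ++ m₂)                         ∎
  where
  open ≡.≡-Reasoning
  open AbsorbPrefix b≤c m₁ (Linked-++⁻ˡ m₁ sm) (AllP.++⁻ˡ m₁ b<m) m₁≤c

InBackQR-resp-≈ : ∀ {f g} → f ≈ˢ g → InBackQR f → InBackQR g
InBackQR-resp-≈ {f} {g} f≈g (((d , deg) , (N , vanish)) , (b , bq)) =
  ((d , λ m sm lt → ≡.trans (sym (f≈g m sm)) (deg m sm lt)) ,
   (N , λ m sm N<m → ≡.trans (sym (f≈g m sm)) (vanish m sm N<m))) ,
  (b , λ k as is js si sj is≤b js≤b m sm b<m →
     ≡.trans (sym (f≈g _ (expand-++-sorted b is as si is≤b sm b<m)))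
       (≡.trans (bq k as is js si sj is≤b js≤b m sm b<m) (f≈g _ (expand-++-sorted b js as sj js≤b sm b<m))))

qsym-backQuasisymmetricAt : ∀ (g : QSym) {b} → b ℤ.≤ ℤ.0ℤ → BackQuasisymmetricAt b (proj₁ g)
qsym-backQuasisymmetricAt (g , _ , vanish , qsym) {b} b≤0 k as is js si sj is≤b js≤b r sr b<r
  with Any.any? (ℤ.0ℤ ℤ.<?_) r
... | yes pos = ≡.trans (vanish _ (expand-++-sorted b is as si is≤b sr b<r) (AnyP.++⁺ʳ (expand is as) pos))
                  (sym (vanish _ (expand-++-sorted b js as sj js≤b sr b<r) (AnyP.++⁺ʳ (expand js as) pos)))
... | no ¬pos = begin
  g (expand is as ++ r)                                ≡⟨ cong g (sym (expand-absorb is as)) ⟩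
  g (expand (is Vec.++ is₁) (as Vec.++ as₁))
    ≡⟨ qsym _ (as Vec.++ as₁) (is Vec.++ is₁) (js Vec.++ is₁) (absorb-increasing is si is≤b) (absorb-increasing js sj js≤b) (absorb-≤ is is≤b) (absorb-≤ js js≤b) ⟩
  g (expand (js Vec.++ is₁) (as Vec.++ as₁))           ≡⟨ cong g (expand-absorb js as) ⟩
  g (expand js as ++ r)                                ∎
  where
  open ≡.≡-Reasoning
  open AbsorbPrefix b≤0 r sr b<r (nonpositive r ¬pos)

qsym-0 : QSym
qsym-0 = 0ˢ , (0 , λ _ _ _ → refl) , (λ _ _ _ → refl) , (λ _ _ _ _ _ _ _ _ → refl)

qsym-+ : QSym → QSym → QSym
qsym-+ (f , (d , f-deg) , f-vanish , f-qsym) (g , (e , g-deg) , g-vanish , g-qsym) =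
  (f +ˢ g) ,
  (d ℕ.⊔ e , λ m sm lt →
     cong₂ ℚ._+_ (f-deg m sm (ℕP.≤-<-trans (ℕP.m≤m⊔n d e) lt)) (g-deg m sm (ℕP.≤-<-trans (ℕP.m≤n⊔m d e) lt))) ,
  (λ m sm pos → cong₂ ℚ._+_ (f-vanish m sm pos) (g-vanish m sm pos)) ,
  (λ k as is js si sj is≤0 js≤0 → cong₂ ℚ._+_ (f-qsym k as is js si sj is≤0 js≤0) (g-qsym k as is js si sj is≤0 js≤0))

qsym-• : ℚ → QSym → QSym
qsym-• c (f , (d , f-deg) , f-vanish , f-qsym) =
  (c •ˢ f) ,
  (d , λ m sm lt → ≡.trans (cong (c ℚ.*_) (f-deg m sm lt)) (ℚP.*-zeroʳ c)) ,
  (λ m sm pos → ≡.trans (cong (c ℚ.*_) (f-vanish m sm pos)) (ℚP.*-zeroʳ c)) ,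
  (λ k as is js si sj is≤0 js≤0 → cong (c ℚ.*_) (f-qsym k as is js si sj is≤0 js≤0))

qsym-neg : QSym → QSym
qsym-neg = qsym-• (ℚ.- 1ℚ)

-- Translating all variables far to the left preserves the coefficient of a quasisymmetric function.
qsym-≈0ˢ : ∀ (g : QSym) L → (∀ s → SortedMon s → All (ℤ._< L) s → proj₁ g s ≡ 0ℚ) → proj₁ g ≈ˢ 0ˢ
qsym-≈0ˢ (g , _ , vanish , qsym) L vanish-left m sm with Any.any? (ℤ.0ℤ ℤ.<?_) m
... | yes pos = vanish m sm pos
... | no ¬pos = begin
  g m                       ≡⟨ cong g (sym expand≡) ⟩
  g (expand is as)          ≡⟨ qsym _ as is js increasing js-increasing is≤0 js≤0 ⟩
  g (expand js as)          ≡⟨ vanish-left _ (expand-sorted js as js-increasing) (expand-All js as js<L) ⟩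
  0ℚ                        ∎
  where
  open ≡.≡-Reasoning
  open ExponentVector (exponentVector m sm)
  D : ℤ
  D = farLeftOf L
  js : Vec ℤ k
  js = Vec.map (ℤ._+ D) is
  js-increasing : StrictlyIncreasing js
  js-increasing = strictlySorted-map (ℤ._+ D) (ℤP.+-monoˡ-< D) is increasing
  is≤0 : All (ℤ._≤ ℤ.0ℤ) (toList is)
  is≤0 = All⁺ (nonpositive m ¬pos)
  i+D≤D : ∀ {i} → i ℤ.≤ ℤ.0ℤ → (i ℤ.+ D) ℤ.≤ D
  i+D≤D {i} i≤0 = subst ((i ℤ.+ D) ℤ.≤_) (ℤP.+-identityˡ D) (ℤP.+-monoˡ-≤ D i≤0)
  js≤0 : All (ℤ._≤ ℤ.0ℤ) (toList js)
  js≤0 = All-toList-map (ℤ._+ D) (λ i≤0 → ℤP.<⇒≤ (ℤP.≤-<-trans (i+D≤D i≤0) (farLeftOf-<0 L))) is is≤0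
  js<L : All (ℤ._< L) (toList js)
  js<L = All-toList-map (ℤ._+ D) (λ i≤0 → ℤP.≤-<-trans (i+D≤D i≤0) (farLeftOf-< L)) is is≤0

∼-∷ : ∀ {x t t'} → t ∼ t' → x ∷ t ∼ x ∷ t'
∼-∷ {x} t∼t' = ∼-++ {x ∷ []} ∼-refl t∼t'

∼-swap : ∀ x y t → x ∷ y ∷ t ∼ y ∷ x ∷ t
∼-swap x y t = ∼-++ {x ∷ y ∷ []} {y ∷ x ∷ []} (∼-comm (x ∷ []) (y ∷ [])) ∼-refl

∼-move : ∀ a x b → a ++ x ∷ b ∼ x ∷ a ++ b
∼-move a x b = subst (_∼ x ∷ a ++ b) (ListP.++-assoc a (x ∷ []) b) (∼-++ (∼-comm a (x ∷ [])) (∼-refl {b}))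

negate : Tensor → Tensor
negate = map (λ (g , p) → (qsym-neg g , p))

-1*x+x≡0 : ∀ x → ℚ.- 1ℚ ℚ.* x ℚ.+ x ≡ 0ℚ
-1*x+x≡0 = solve 1 (λ x → con (ℚ.- 1ℚ) :* x :+ x := con 0ℚ) refl
  where open +-*-Solver

negate-++-cancel : ∀ t → negate t ++ t ∼ []
negate-++-cancel [] = ∼-refl
negate-++-cancel ((g , p) ∷ t) =
  ∼-trans (∼-∷ (∼-move (negate t) (g , p) t))
    (∼-++ {(qsym-neg g , p) ∷ (g , p) ∷ []} {[]} pair-cancel (negate-++-cancel t))
  where
  g' : QSym
  g' = qsym-+ (qsym-neg g) g
  pair-cancel : (qsym-neg g , p) ∷ (g , p) ∷ [] ∼ []
  pair-cancel = ∼-trans (∼-sym (∼-addL g' (qsym-neg g) g p (λ _ _ → refl)))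
                        (∼-zero g' p (λ m _ → -1*x+x≡0 (proj₁ g m)))

mult-++ : ∀ t t' m → mult (t ++ t') m ≡ mult t m ℚ.+ mult t' m
mult-++ [] t' m = sym (ℚP.+-identityˡ _)
mult-++ ((g , p) ∷ t) t' m =
  ≡.trans (cong ((proj₁ g ·ᵖ p) m ℚ.+_) (mult-++ t t' m)) (sym (ℚP.+-assoc ((proj₁ g ·ᵖ p) m) (mult t m) (mult t' m)))

·ᵖ-neg : ∀ g p m → (proj₁ (qsym-neg g) ·ᵖ p) m ≡ ℚ.- 1ℚ ℚ.* (proj₁ g ·ᵖ p) m
·ᵖ-neg g [] m = refl
·ᵖ-neg g ((c , u) ∷ p) m with monus m u
... | just r rewrite ·ᵖ-neg g p m = solve 3 (λ c x y → c :* (con (ℚ.- 1ℚ) :* x) :+ con (ℚ.- 1ℚ) :* y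
                                                    := con (ℚ.- 1ℚ) :* (c :* x :+ y)) refl c (proj₁ g r) _
  where open +-*-Solver
... | nothing = ·ᵖ-neg g p m

mult-negate : ∀ t m → mult (negate t) m ≡ ℚ.- 1ℚ ℚ.* mult t m
mult-negate [] m = refl
mult-negate ((g , p) ∷ t) m =
  ≡.trans (cong₂ ℚ._+_ (·ᵖ-neg g p m) (mult-negate t m))
          (sym (ℚP.*-distribˡ-+ (ℚ.- 1ℚ) ((proj₁ g ·ᵖ p) m) (mult t m)))

-- t ∼ t ++ (negate t' ++ t') ∼ (t ++ negate t') ++ t' ∼ t'
mult-injective-from-kernel : (∀ t → mult t ≈ˢ 0ˢ → t ∼ []) → ∀ t t' → mult t ≈ˢ mult t' → t ∼ t'
mult-injective-from-kernel kernel t t' t≈t' =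
  ∼-trans (subst (_∼ t ++ (negate t' ++ t')) (ListP.++-identityʳ t) (∼-++ (∼-refl {t}) (∼-sym (negate-++-cancel t'))))
    (subst (_∼ t') (ListP.++-assoc t (negate t') t')
      (∼-++ {t ++ negate t'} {[]} (kernel (t ++ negate t') difference≈0) (∼-refl {t'})))
  where
  difference≈0 : mult (t ++ negate t') ≈ˢ 0ˢ
  difference≈0 m sm = begin
    mult (t ++ negate t') m                          ≡⟨ mult-++ t (negate t') m ⟩
    mult t m ℚ.+ mult (negate t') m                  ≡⟨ cong₂ ℚ._+_ (t≈t' m sm) (mult-negate t' m) ⟩
    mult t' m ℚ.+ ℚ.- 1ℚ ℚ.* mult t' m               ≡⟨ ℚP.+-comm (mult t' m) _ ⟩
    ℚ.- 1ℚ ℚ.* mult t' m ℚ.+ mult t' m               ≡⟨ -1*x+x≡0 (mult t' m) ⟩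
    0ℚ                                               ∎
    where open ≡.≡-Reasoning

x^_∙_ : Monomial → Series → Series
(x^ u ∙ h) w with monus w u
... | just r = h r
... | nothing = 0ℚ

x^∙-just : ∀ u h w {r} → monus w u ≡ just r → (x^ u ∙ h) w ≡ h r
x^∙-just u h w eq rewrite eq = refl

x^∙-nothing : ∀ u h w → monus w u ≡ nothing → (x^ u ∙ h) w ≡ 0ℚ
x^∙-nothing u h w eq rewrite eq = refl

x^∙-+ : ∀ u (A B : Series) w → (x^ u ∙ (A +ˢ B)) w ≡ (x^ u ∙ A) w ℚ.+ (x^ u ∙ B) w
x^∙-+ u A B w with monus w u
... | just r = refl
... | nothing = refl

x^∙-0 : ∀ u w → (x^ u ∙ 0ˢ) w ≡ 0ℚ
x^∙-0 u w with monus w u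
... | just r = refl
... | nothing = refl

x^∙-cong : ∀ u {A B : Series} w → (∀ r → A r ≡ B r) → (x^ u ∙ A) w ≡ (x^ u ∙ B) w
x^∙-cong u w A≗B with monus w u
... | just r = A≗B r
... | nothing = refl

·ᵖ-∷ : ∀ g c u p m → (g ·ᵖ ((c , u) ∷ p)) m ≡ (g ·ᵖ ((c , u) ∷ [])) m ℚ.+ (g ·ᵖ p) m
·ᵖ-∷ g c u p m with monus m u
... | just r = cong (ℚ._+ (g ·ᵖ p) m) (sym (ℚP.+-identityʳ (c ℚ.* g r)))
... | nothing = sym (ℚP.+-identityˡ _)

·ᵖ-monomial : ∀ g c u m → (g ·ᵖ ((c , u) ∷ [])) m ≡ (x^ u ∙ (c •ˢ g)) m
·ᵖ-monomial g c u m with monus m u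
... | just r = ℚP.+-identityʳ (c ℚ.* g r)
... | nothing = refl

x^∙-sort : ∀ u h m → (x^ u ∙ h) m ≡ (x^ sort u ∙ h) m
x^∙-sort u h m rewrite monus-↭ (sort-↭ u) m = refl

-- Sums of pure tensors h ⊗ x^v

Elementary : Set
Elementary = List (QSym × Monomial)

embed : Elementary → Tensor
embed = map (λ (h , v) → (h , (1ℚ , v) ∷ []))

⟦_⟧ : Elementary → Series
⟦ [] ⟧ m = 0ℚ
⟦ (h , v) ∷ E ⟧ m = (x^ v ∙ proj₁ h) m ℚ.+ ⟦ E ⟧ m

⟦⟧-++ : ∀ E F m → ⟦ E ++ F ⟧ m ≡ ⟦ E ⟧ m ℚ.+ ⟦ F ⟧ m
⟦⟧-++ [] F m = sym (ℚP.+-identityˡ _)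
⟦⟧-++ ((h , v) ∷ E) F m =
  ≡.trans (cong (x ℚ.+_) (⟦⟧-++ E F m)) (sym (ℚP.+-assoc x (⟦ E ⟧ m) (⟦ F ⟧ m)))
  where x = (x^ v ∙ proj₁ h) m

elementaryᵖ : QSym → Poly → Elementary
elementaryᵖ g [] = []
elementaryᵖ g ((c , u) ∷ p) = (qsym-• c g , sort u) ∷ elementaryᵖ g p

elementary : Tensor → Elementary
elementary [] = []
elementary ((g , p) ∷ t) = elementaryᵖ g p ++ elementary t

SortedMonomials : Elementary → Set
SortedMonomials = All (SortedMon ∘ proj₂)

elementary-sorted : ∀ t → SortedMonomials (elementary t)
elementary-sorted [] = []
elementary-sorted ((g , p) ∷ t) = AllP.++⁺ (elementaryᵖ-sorted p) (elementary-sorted t)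
  where
  elementaryᵖ-sorted : ∀ p → SortedMonomials (elementaryᵖ g p)
  elementaryᵖ-sorted [] = []
  elementaryᵖ-sorted ((c , u) ∷ p) = sort-↗ u ∷ elementaryᵖ-sorted p

∼-elementaryᵖ : ∀ g p → (g , p) ∷ [] ∼ embed (elementaryᵖ g p)
∼-elementaryᵖ g [] = ∼-trans (∼-sym (∼-smul 0ℚ g qsym-0 [] (λ m _ → sym (ℚP.*-zeroˡ (proj₁ g m)))))
                             (∼-zero qsym-0 [] (λ _ _ → refl))
∼-elementaryᵖ g ((c , u) ∷ p) =
  ∼-trans (∼-addR g ((c , u) ∷ []) p) (∼-++ {(g , (c , u) ∷ []) ∷ []} ∼-term (∼-elementaryᵖ g p))
  where
  ∼-term : (g , (c , u) ∷ []) ∷ [] ∼ (qsym-• c g , (1ℚ , sort u) ∷ []) ∷ []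
  ∼-term = ∼-sym (∼-trans (∼-smul c g (qsym-• c g) ((1ℚ , sort u) ∷ []) (λ _ _ → refl)) (∼-elt g g (λ _ _ → refl) c·x^u≈c·x^u))
    where
    c·x^u≈c·x^u : ((c ℚ.* 1ℚ , sort u) ∷ []) ≈ᵖ ((c , u) ∷ [])
    c·x^u≈c·x^u m _ rewrite ℚP.*-identityʳ c | monus-↭ (sort-↭ u) m = refl

∼-elementary : ∀ t → t ∼ embed (elementary t)
∼-elementary [] = ∼-refl
∼-elementary ((g , p) ∷ t) =
  subst ((g , p) ∷ t ∼_) (sym (ListP.map-++ _ (elementaryᵖ g p) (elementary t)))
        (∼-++ {(g , p) ∷ []} (∼-elementaryᵖ g p) (∼-elementary t))

mult≡⟦elementary⟧ : ∀ t m → mult t m ≡ ⟦ elementary t ⟧ m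
mult≡⟦elementary⟧ [] m = refl
mult≡⟦elementary⟧ ((g , p) ∷ t) m =
  ≡.trans (cong₂ ℚ._+_ (·ᵖ≡⟦elementaryᵖ⟧ p) (mult≡⟦elementary⟧ t m)) (sym (⟦⟧-++ (elementaryᵖ g p) (elementary t) m))
  where
  ·ᵖ≡⟦elementaryᵖ⟧ : ∀ p → (proj₁ g ·ᵖ p) m ≡ ⟦ elementaryᵖ g p ⟧ m
  ·ᵖ≡⟦elementaryᵖ⟧ [] = refl
  ·ᵖ≡⟦elementaryᵖ⟧ ((c , u) ∷ p) =
    ≡.trans (·ᵖ-∷ (proj₁ g) c u p m)
      (cong₂ ℚ._+_ (≡.trans (·ᵖ-monomial (proj₁ g) c u m) (x^∙-sort u _ m)) (·ᵖ≡⟦elementaryᵖ⟧ p))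

insert : QSym × Monomial → Elementary → Elementary
insert (h , v) [] = (h , v) ∷ []
insert (h , v) ((h' , v') ∷ E) with ListP.≡-dec ℤ._≟_ v v'
... | yes _ = (qsym-+ h' h , v') ∷ E
... | no _ = (h' , v') ∷ insert (h , v) E

collect : Elementary → Elementary
collect [] = []
collect (e ∷ E) = insert e (collect E)

DistinctMonomials : Elementary → Set
DistinctMonomials = AllPairs (λ e e' → proj₂ e ≢ proj₂ e')

⟦insert⟧ : ∀ e E m → ⟦ insert e E ⟧ m ≡ ⟦ e ∷ E ⟧ m
⟦insert⟧ (h , v) [] m = refl
⟦insert⟧ (h , v) ((h' , v') ∷ E) m with ListP.≡-dec ℤ._≟_ v v'
... | yes refl = ≡.trans (cong (ℚ._+ ⟦ E ⟧ m) (x^∙-+ v (proj₁ h') (proj₁ h) m))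
                   (xy∙z≈y∙xz ((x^ v ∙ proj₁ h') m) ((x^ v ∙ proj₁ h) m) (⟦ E ⟧ m))
... | no _ = ≡.trans (cong ((x^ v' ∙ proj₁ h') m ℚ.+_) (⟦insert⟧ (h , v) E m))
               (x∙yz≈y∙xz ((x^ v' ∙ proj₁ h') m) ((x^ v ∙ proj₁ h) m) (⟦ E ⟧ m))

∼-insert : ∀ e E → embed (e ∷ E) ∼ embed (insert e E)
∼-insert (h , v) [] = ∼-refl
∼-insert (h , v) ((h' , v') ∷ E) with ListP.≡-dec ℤ._≟_ v v'
... | yes refl = ∼-trans (∼-swap _ _ _)
                   (∼-++ {(h' , p) ∷ (h , p) ∷ []} {(qsym-+ h' h , p) ∷ []}
                         (∼-sym (∼-addL (qsym-+ h' h) h' h p (λ _ _ → refl))) ∼-refl)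
  where p = (1ℚ , v) ∷ []
... | no _ = ∼-trans (∼-swap _ _ _) (∼-∷ (∼-insert (h , v) E))

insert-All : ∀ {P : Monomial → Set} e E → P (proj₂ e) → All (P ∘ proj₂) E → All (P ∘ proj₂) (insert e E)
insert-All (h , v) [] Pv [] = Pv ∷ []
insert-All (h , v) ((h' , v') ∷ E) Pv (Pv' ∷ PE) with ListP.≡-dec ℤ._≟_ v v'
... | yes refl = Pv' ∷ PE
... | no _ = Pv' ∷ insert-All (h , v) E Pv PE

insert-distinct : ∀ e E → DistinctMonomials E → DistinctMonomials (insert e E)
insert-distinct (h , v) [] [] = [] ∷ []
insert-distinct (h , v) ((h' , v') ∷ E) (v'∉ ∷ distinct) with ListP.≡-dec ℤ._≟_ v v'
... | yes refl = v'∉ ∷ distinct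
... | no v≢v' = insert-All {v' ≢_} (h , v) E (v≢v' ∘ sym) v'∉ ∷ insert-distinct (h , v) E distinct

∼-collect : ∀ E → embed E ∼ embed (collect E)
∼-collect [] = ∼-refl
∼-collect (e ∷ E) = ∼-trans (∼-∷ (∼-collect E)) (∼-insert e (collect E))

⟦collect⟧ : ∀ E m → ⟦ collect E ⟧ m ≡ ⟦ E ⟧ m
⟦collect⟧ [] m = refl
⟦collect⟧ ((h , v) ∷ E) m = ≡.trans (⟦insert⟧ (h , v) (collect E) m) (cong ((x^ v ∙ proj₁ h) m ℚ.+_) (⟦collect⟧ E m))

collect-distinct : ∀ E → DistinctMonomials (collect E)
collect-distinct [] = []
collect-distinct (e ∷ E) = insert-distinct e (collect E) (collect-distinct E)

collect-sorted : ∀ E → SortedMonomials E → SortedMonomials (collect E)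
collect-sorted [] [] = []
collect-sorted (e ∷ E) (se ∷ sE) = insert-All e (collect E) se (collect-sorted E sE)

-- Injectivity

module FarLeftCoefficient (L : ℤ) {v : Monomial} (sv : SortedMon v) (L≤v : All (L ℤ.≤_) v)
                          {s : Monomial} (ss : SortedMon s) (s<L : All (ℤ._< L) s) where

  Admissible : QSym × Monomial → Set
  Admissible (h' , v') = SortedMon v' × All (L ℤ.≤_) v' × (length v' ℕ.< length v → proj₁ h' ≈ˢ 0ˢ)

  monus-s++ : ∀ {v'} → All (L ℤ.≤_) v' → monus (s ++ v) v' ≡ Maybe.map (s ++_) (monus v v')
  monus-s++ L≤v' = monus-++ˡ s v _ λ i∈v' i∈s →
    ℤP.<-irrefl refl (ℤP.<-≤-trans (All.lookup s<L i∈s) (All.lookup L≤v' i∈v'))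

  s++-sorted : ∀ {w} → SortedMon w → All (L ℤ.≤_) w → SortedMon (s ++ w)
  s++-sorted sw L≤w = ≤-Linked.++⁺ ss sw (All.map (λ y<L → All.map (ℤP.<⇒≤ ∘ ℤP.<-≤-trans y<L) L≤w) s<L)

  x^∙-other : ∀ h' v' → Admissible (h' , v') → v ≢ v' → (x^ v' ∙ proj₁ h') (s ++ v) ≡ 0ℚ
  x^∙-other h' v' (sv' , L≤v' , shorter⇒0) v≢v' with monus v v' in e
  ... | nothing = x^∙-nothing v' _ (s ++ v) (≡.trans (monus-s++ L≤v') (cong (Maybe.map (s ++_)) e))
  ... | just [] = ⊥-elim (v≢v' (monus≡just[]⇒≡ v v' sv sv' e))
  ... | just (x ∷ r) =
    ≡.trans (x^∙-just v' _ (s ++ v) (≡.trans (monus-s++ L≤v') (cong (Maybe.map (s ++_)) e)))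
            (shorter⇒0 shorter (s ++ x ∷ r) (s++-sorted (monus-sorted v v' sv e) (monus-All v v' L≤v e)))
    where
    shorter : length v' ℕ.< length v
    shorter = subst (length v' ℕ.<_) (sym (monus-length v v' e)) (ℕP.m<m+n (length v') ℕ.z<s)

  x^∙-self : ∀ (h : QSym) → (x^ v ∙ proj₁ h) (s ++ v) ≡ proj₁ h s
  x^∙-self h = ≡.trans (x^∙-just v _ (s ++ v) (≡.trans (monus-s++ L≤v) (cong (Maybe.map (s ++_)) (monus-self v))))
                       (cong (proj₁ h) (ListP.++-identityʳ s))

  ⟦⟧-∉ : ∀ E → All Admissible E → All (λ e → v ≢ proj₂ e) E → ⟦ E ⟧ (s ++ v) ≡ 0ℚ
  ⟦⟧-∉ [] _ _ = refl
  ⟦⟧-∉ ((h' , v') ∷ E) (adm ∷ adms) (v≢v' ∷ v∉E) =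
    ≡.trans (cong₂ ℚ._+_ (x^∙-other h' v' adm v≢v') (⟦⟧-∉ E adms v∉E)) (ℚP.+-identityˡ 0ℚ)

  ⟦⟧-∈ : ∀ E → DistinctMonomials E → All Admissible E → ∀ (h : QSym) → (h , v) ∈ E → ⟦ E ⟧ (s ++ v) ≡ proj₁ h s
  ⟦⟧-∈ (.(h , v) ∷ E) (v∉E ∷ _) (_ ∷ adms) h (here refl) =
    ≡.trans (cong₂ ℚ._+_ (x^∙-self h) (⟦⟧-∉ E adms v∉E)) (ℚP.+-identityʳ _)
  ⟦⟧-∈ ((h' , v') ∷ E) (v'∉E ∷ distinct) (adm ∷ adms) h (there hv∈E) =
    ≡.trans (cong₂ ℚ._+_ (x^∙-other h' v' adm (λ v≡v' → All.lookup v'∉E hv∈E (sym v≡v'))) (⟦⟧-∈ E distinct adms h hv∈E))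
            (ℚP.+-identityˡ _)

-- By induction on the length of v, reading off the coefficients of s ++ v for s far to the left.
⟦⟧-kernel : ∀ E → DistinctMonomials E → SortedMonomials E → ⟦ E ⟧ ≈ˢ 0ˢ → All (λ e → proj₁ (proj₁ e) ≈ˢ 0ˢ) E
⟦⟧-kernel E distinct sorted E≈0 = All.tabulate (λ {e} e∈E → vanishes (suc (length (proj₂ e))) e∈E (ℕP.n<1+n _))
  where
  L : ℤ
  L = lowerBound (concat (map proj₂ E))

  L≤E : All (λ e → All (L ℤ.≤_) (proj₂ e)) E
  L≤E = AllP.map⁻ (AllP.concat⁻ (lowerBound-≤ (concat (map proj₂ E))))

  vanishes : ∀ n {e} → e ∈ E → length (proj₂ e) ℕ.< n → proj₁ (proj₁ e) ≈ˢ 0ˢ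
  vanishes (suc n) {h , v} e∈E (ℕ.s≤s |v|≤n) = qsym-≈0ˢ h L vanishes-far-left
    where
    vanishes-far-left : ∀ s → SortedMon s → All (ℤ._< L) s → proj₁ h s ≡ 0ℚ
    vanishes-far-left s ss s<L =
      ≡.trans (sym (⟦⟧-∈ E distinct admissible h e∈E)) (E≈0 (s ++ v) (s++-sorted (All.lookup sorted e∈E) (All.lookup L≤E e∈E)))
      where
      open FarLeftCoefficient L (All.lookup sorted e∈E) (All.lookup L≤E e∈E) ss s<L
      admissible : All Admissible E
      admissible = All.tabulate λ e'∈E →
        All.lookup sorted e'∈E , All.lookup L≤E e'∈E , λ lt → vanishes n e'∈E (ℕP.<-≤-trans lt |v|≤n)

embed-∼-[] : ∀ E → All (λ e → proj₁ (proj₁ e) ≈ˢ 0ˢ) E → embed E ∼ []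
embed-∼-[] [] [] = ∼-refl
embed-∼-[] ((h , v) ∷ E) (h≈0 ∷ E≈0) = ∼-++ {(h , (1ℚ , v) ∷ []) ∷ []} {[]} (∼-zero h _ h≈0) (embed-∼-[] E E≈0)

mult-kernel : ∀ t → mult t ≈ˢ 0ˢ → t ∼ []
mult-kernel t t≈0 =
  ∼-trans (∼-elementary t)
    (∼-trans (∼-collect E)
      (embed-∼-[] (collect E) (⟦⟧-kernel (collect E) (collect-distinct E) (collect-sorted E (elementary-sorted t)) collected≈0)))
  where
  E : Elementary
  E = elementary t
  collected≈0 : ⟦ collect E ⟧ ≈ˢ 0ˢ
  collected≈0 m sm = ≡.trans (⟦collect⟧ E m) (≡.trans (sym (mult≡⟦elementary⟧ t m)) (t≈0 m sm))

mult-injective : ∀ t t' → mult t ≈ˢ mult t' → t ∼ t'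
mult-injective = mult-injective-from-kernel mult-kernel

-- The image of the multiplication map lies in QR←

variablesᵖ : Poly → List ℤ
variablesᵖ [] = []
variablesᵖ ((c , u) ∷ p) = u ++ variablesᵖ p

variables : Tensor → List ℤ
variables [] = []
variables ((g , p) ∷ t) = variablesᵖ p ++ variables t

boundedDegree-+ : ∀ {f g} → BoundedDegree f → BoundedDegree g → BoundedDegree (f +ˢ g)
boundedDegree-+ (d , f-deg) (e , g-deg) =
  d ℕ.⊔ e , λ m sm lt →
    ≡.trans (cong₂ ℚ._+_ (f-deg m sm (ℕP.≤-<-trans (ℕP.m≤m⊔n d e) lt)) (g-deg m sm (ℕP.≤-<-trans (ℕP.m≤n⊔m d e) lt)))
            (ℚP.+-identityˡ 0ℚ)

boundedDegree-≗ : ∀ {f g} → (∀ m → g m ≡ f m) → BoundedDegree f → BoundedDegree g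
boundedDegree-≗ g≗f (d , f-deg) = d , λ m sm lt → ≡.trans (g≗f m) (f-deg m sm lt)

·ᵖ-boundedDegree : ∀ (g : QSym) p → BoundedDegree (proj₁ g ·ᵖ p)
·ᵖ-boundedDegree g [] = 0 , λ _ _ _ → refl
·ᵖ-boundedDegree g@(g₀ , (d , g-deg) , _) ((c , u) ∷ p) =
  boundedDegree-≗ (·ᵖ-∷ g₀ c u p) (boundedDegree-+ (d ℕ.+ length u , term-deg) (·ᵖ-boundedDegree g p))
  where
  term-deg : ∀ m → SortedMon m → d ℕ.+ length u ℕ.< length m → (g₀ ·ᵖ ((c , u) ∷ [])) m ≡ 0ℚ
  term-deg m sm lt with monus m u in e
  ... | nothing = refl
  ... | just r = ≡.trans (cong (λ x → c ℚ.* x ℚ.+ 0ℚ) (g-deg r (monus-sorted m u sm e) d<|r|))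
                   (≡.trans (ℚP.+-identityʳ _) (ℚP.*-zeroʳ c))
    where
    d<|r| : d ℕ.< length r
    d<|r| = ℕP.+-cancelʳ-< (length u) d (length r)
              (subst (d ℕ.+ length u ℕ.<_) (≡.trans (monus-length m u e) (ℕP.+-comm (length u) (length r))) lt)

mult-boundedDegree : ∀ t → BoundedDegree (mult t)
mult-boundedDegree [] = 0 , λ _ _ _ → refl
mult-boundedDegree ((g , p) ∷ t) = boundedDegree-+ (·ᵖ-boundedDegree g p) (mult-boundedDegree t)

·ᵖ-vanishesAbove : ∀ (g : QSym) p {N} → ℤ.0ℤ ℤ.≤ N → All (ℤ._≤ N) (variablesᵖ p) → VanishesAbove N (proj₁ g ·ᵖ p)
·ᵖ-vanishesAbove g [] _ _ m _ _ = refl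
·ᵖ-vanishesAbove g@(g₀ , _ , g-vanish , _) ((c , u) ∷ p) 0≤N p≤N m sm N<m with monus m u in e
... | nothing = ·ᵖ-vanishesAbove g p 0≤N (AllP.++⁻ʳ u p≤N) m sm N<m
... | just r = ≡.trans (cong₂ ℚ._+_ (≡.trans (cong (c ℚ.*_) (g-vanish r (monus-sorted m u sm e) 0<r)) (ℚP.*-zeroʳ c))
                                    (·ᵖ-vanishesAbove g p 0≤N (AllP.++⁻ʳ u p≤N) m sm N<m))
                       (ℚP.+-identityˡ 0ℚ)
  where
  0<r : Any (ℤ.0ℤ ℤ.<_) r
  0<r with find N<m
  ... | j , j∈m , N<j = lose (monus-∈⁺ m u e j∈m (λ j∈u → ℤP.<⇒≱ N<j (All.lookup (AllP.++⁻ˡ u p≤N) j∈u)))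
                             (ℤP.≤-<-trans 0≤N N<j)

mult-vanishesAbove : ∀ t {N} → ℤ.0ℤ ℤ.≤ N → All (ℤ._≤ N) (variables t) → VanishesAbove N (mult t)
mult-vanishesAbove [] _ _ m _ _ = refl
mult-vanishesAbove ((g , p) ∷ t) 0≤N t≤N m sm N<m =
  ≡.trans (cong₂ ℚ._+_ (·ᵖ-vanishesAbove g p 0≤N (AllP.++⁻ˡ (variablesᵖ p) t≤N) m sm N<m)
                       (mult-vanishesAbove t 0≤N (AllP.++⁻ʳ (variablesᵖ p) t≤N) m sm N<m))
          (ℚP.+-identityˡ 0ℚ)

expand-disjoint : ∀ {b u} → All (b ℤ.<_) u → ∀ {k} (xs : Vec ℤ k) as → All (ℤ._≤ b) (toList xs) →
                  Disjoint u (expand xs as)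
expand-disjoint b<u xs as xs≤b i∈u i∈xs = ℤP.<⇒≱ (All.lookup b<u i∈u) (All.lookup (expand-All xs as xs≤b) i∈xs)

·ᵖ-backQuasisymmetricAt : ∀ (g : QSym) p {b} → b ℤ.≤ ℤ.0ℤ → All (b ℤ.<_) (variablesᵖ p) →
                          BackQuasisymmetricAt b (proj₁ g ·ᵖ p)
·ᵖ-backQuasisymmetricAt g [] _ _ k as is js si sj is≤b js≤b m sm b<m = refl
·ᵖ-backQuasisymmetricAt g ((c , u) ∷ p) {b} b≤0 b<p k as is js si sj is≤b js≤b m sm b<m
  rewrite monus-++ˡ (expand is as) m u (expand-disjoint (AllP.++⁻ˡ u b<p) is as is≤b) | monus-++ˡ (expand js as) m u (expand-disjoint (AllP.++⁻ˡ u b<p) js as js≤b)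
  with monus m u in e
... | just r = cong₂ ℚ._+_ (cong (c ℚ.*_) (qsym-backQuasisymmetricAt g b≤0 k as is js si sj is≤b js≤b r
                                             (monus-sorted m u sm e) (monus-All m u b<m e)))
                           (·ᵖ-backQuasisymmetricAt g p b≤0 (AllP.++⁻ʳ u b<p) k as is js si sj is≤b js≤b m sm b<m)
... | nothing = ·ᵖ-backQuasisymmetricAt g p b≤0 (AllP.++⁻ʳ u b<p) k as is js si sj is≤b js≤b m sm b<m

mult-backQuasisymmetricAt : ∀ t {b} → b ℤ.≤ ℤ.0ℤ → All (b ℤ.<_) (variables t) → BackQuasisymmetricAt b (mult t)
mult-backQuasisymmetricAt [] _ _ k as is js si sj is≤b js≤b m sm b<m = refl
mult-backQuasisymmetricAt ((g , p) ∷ t) b≤0 b<t k as is js si sj is≤b js≤b m sm b<m =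
  cong₂ ℚ._+_ (·ᵖ-backQuasisymmetricAt g p b≤0 (AllP.++⁻ˡ (variablesᵖ p) b<t) k as is js si sj is≤b js≤b m sm b<m)
              (mult-backQuasisymmetricAt t b≤0 (AllP.++⁻ʳ (variablesᵖ p) b<t) k as is js si sj is≤b js≤b m sm b<m)

mult-InBackQR : ∀ t → InBackQR (mult t)
mult-InBackQR t =
  (mult-boundedDegree t , N , mult-vanishesAbove t (0≤upperBound (variables t)) (upperBound-≥ (variables t))) ,
  (b , mult-backQuasisymmetricAt t (ℤP.<⇒≤ (farLeftOf-<0 L)) (All.map (ℤP.<-≤-trans (farLeftOf-< L)) (lowerBound-≤ (variables t))))
  where
  N L b : ℤ
  N = upperBound (variables t)
  L = lowerBound (variables t)
  b = farLeftOf L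

-- Slicing a series along one variable

below above : ℤ → List ℤ → List ℤ
below c = filter (ℤ._<? c)
above c = filter (c ℤ.<?_)

multiplicity : ℤ → List ℤ → ℕ
multiplicity c w = length (filter (ℤ._≟ c) w)

Around : ℤ → List ℤ → List ℤ → Set
Around c lo hi = All (ℤ._< c) lo × All (c ℤ.<_) hi

module _ {c : ℤ} {lo hi : List ℤ} (around : Around c lo hi) (j : ℕ) where

  private
    lo<c : All (ℤ._< c) lo
    lo<c = proj₁ around

    c<hi : All (c ℤ.<_) hi
    c<hi = proj₂ around

  below-around : below c (lo ++ replicate j c ++ hi) ≡ lo
  below-around = begin
    below c (lo ++ replicate j c ++ hi)                        ≡⟨ ListP.filter-++ (ℤ._<? c) lo _ ⟩
    below c lo ++ below c (replicate j c ++ hi)                ≡⟨ cong (below c lo ++_) (ListP.filter-++ (ℤ._<? c) (replicate j c) hi) ⟩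
    below c lo ++ below c (replicate j c) ++ below c hi
      ≡⟨ cong₂ _++_ (ListP.filter-all (ℤ._<? c) lo<c)
                    (cong₂ _++_ (ListP.filter-none (ℤ._<? c) (AllP.replicate⁺ j (ℤP.<-irrefl refl)))
                                (ListP.filter-none (ℤ._<? c) (All.map ℤP.<-asym c<hi))) ⟩
    lo ++ []                                                   ≡⟨ ListP.++-identityʳ lo ⟩
    lo                                                         ∎
    where open ≡.≡-Reasoning

  above-around : above c (lo ++ replicate j c ++ hi) ≡ hi
  above-around = begin
    above c (lo ++ replicate j c ++ hi)                        ≡⟨ ListP.filter-++ (c ℤ.<?_) lo _ ⟩
    above c lo ++ above c (replicate j c ++ hi)                ≡⟨ cong (above c lo ++_) (ListP.filter-++ (c ℤ.<?_) (replicate j c) hi) ⟩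
    above c lo ++ above c (replicate j c) ++ above c hi
      ≡⟨ cong₂ _++_ (ListP.filter-none (c ℤ.<?_) (All.map ℤP.<-asym lo<c))
                    (cong₂ _++_ (ListP.filter-none (c ℤ.<?_) (AllP.replicate⁺ j (ℤP.<-irrefl refl)))
                                (ListP.filter-all (c ℤ.<?_) c<hi)) ⟩
    hi                                                         ∎
    where open ≡.≡-Reasoning

  multiplicity-around : multiplicity c (lo ++ replicate j c ++ hi) ≡ j
  multiplicity-around = begin
    length (filter (ℤ._≟ c) (lo ++ replicate j c ++ hi))
      ≡⟨ cong length (≡.trans (ListP.filter-++ (ℤ._≟ c) lo _) (cong (filter (ℤ._≟ c) lo ++_) (ListP.filter-++ (ℤ._≟ c) (replicate j c) hi))) ⟩
    length (filter (ℤ._≟ c) lo ++ filter (ℤ._≟ c) (replicate j c) ++ filter (ℤ._≟ c) hi)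
      ≡⟨ cong length (cong₂ _++_ (ListP.filter-none (ℤ._≟ c) (All.map ℤP.<⇒≢ lo<c))
                       (cong₂ _++_ (ListP.filter-all (ℤ._≟ c) (AllP.replicate⁺ j refl))
                                   (ListP.filter-none (ℤ._≟ c) (All.map (λ c<y → ℤP.<⇒≢ c<y ∘ sym) c<hi)))) ⟩
    length (replicate j c ++ [])                               ≡⟨ cong length (ListP.++-identityʳ (replicate j c)) ⟩
    length (replicate j c)                                     ≡⟨ ListP.length-replicate j ⟩
    j                                                          ∎
    where open ≡.≡-Reasoning

  around-sorted : SortedMon lo → SortedMon hi → SortedMon (lo ++ replicate j c ++ hi)
  around-sorted slo shi =
    ≤-Linked.++⁺ slo (≤-Linked.++⁺ (replicate-sorted j c) shi (AllP.replicate⁺ j (All.map ℤP.<⇒≤ c<hi)))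
      (All.map (λ x<c → AllP.++⁺ (AllP.replicate⁺ j (ℤP.<⇒≤ x<c)) (All.map (ℤP.<⇒≤ ∘ ℤP.<-trans x<c) c<hi)) lo<c)

  monus-replicate : ∀ a → monus (lo ++ replicate (a ℕ.+ j) c ++ hi) (replicate a c) ≡ just (lo ++ replicate j c ++ hi)
  monus-replicate zero = refl
  monus-replicate (suc a)
    rewrite monus-∷ (lo ++ replicate (suc a ℕ.+ j) c ++ hi) c (replicate a c)
          | remove-++ˡ c lo (replicate (suc a ℕ.+ j) c ++ hi) (All-<⇒∉ lo<c)
          | remove-here c (replicate (a ℕ.+ j) c ++ hi) = monus-replicate a

monus-replicate-> : ∀ {c lo hi} → Around c lo hi → ∀ k a → k ℕ.< a →
                    monus (lo ++ replicate k c ++ hi) (replicate a c) ≡ nothing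
monus-replicate-> {c} {lo} {hi} (lo<c , c<hi) zero (suc a) _
  rewrite monus-∷ (lo ++ hi) c (replicate a c) | remove-++ˡ c lo hi (All-<⇒∉ lo<c)
        | remove-∉ c hi (All->⇒∉ c<hi) = refl
monus-replicate-> {c} {lo} {hi} around@(lo<c , _) (suc k) (suc a) (ℕ.s≤s k<a)
  rewrite monus-∷ (lo ++ replicate (suc k) c ++ hi) c (replicate a c)
        | remove-++ˡ c lo (replicate (suc k) c ++ hi) (All-<⇒∉ lo<c)
        | remove-here c (replicate k c ++ hi) = monus-replicate-> around k a k<a

++-replicate-cong : ∀ (c : ℤ) {lo lo' k k' hi hi'} → lo ≡ lo' → k ≡ k' → hi ≡ hi' →
                    lo ++ replicate k c ++ hi ≡ lo' ++ replicate k' c ++ hi'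
++-replicate-cong c refl refl refl = refl

decompose : ∀ c w → SortedMon w → w ≡ below c w ++ replicate (multiplicity c w) c ++ above c w
decompose c [] _ = refl
decompose c (x ∷ xs) sw with ℤP.<-cmp x c
... | tri< x<c x≢c _ = begin
  x ∷ xs                                                          ≡⟨ cong (x ∷_) (decompose c xs (Linked.tail sw)) ⟩
  (x ∷ below c xs) ++ replicate (multiplicity c xs) c ++ above c xs
    ≡⟨ ++-replicate-cong c (sym (ListP.filter-accept (ℤ._<? c) x<c)) (cong length (sym (ListP.filter-reject (ℤ._≟ c) x≢c)))
                           (sym (ListP.filter-reject (c ℤ.<?_) (ℤP.<-asym x<c))) ⟩
  below c (x ∷ xs) ++ replicate (multiplicity c (x ∷ xs)) c ++ above c (x ∷ xs) ∎
  where open ≡.≡-Reasoning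
... | tri≈ _ refl _ = begin
  x ∷ xs                                                          ≡⟨ cong (x ∷_) (decompose x xs (Linked.tail sw)) ⟩
  x ∷ below x xs ++ replicate (multiplicity x xs) x ++ above x xs ≡⟨ cong (λ lo → x ∷ lo ++ replicate (multiplicity x xs) x ++ above x xs) below≡[] ⟩
  [] ++ replicate (suc (multiplicity x xs)) x ++ above x xs
    ≡⟨ ++-replicate-cong x (sym (≡.trans (ListP.filter-reject (ℤ._<? x) (ℤP.<-irrefl refl)) below≡[]))
                           (cong length (sym (ListP.filter-accept (ℤ._≟ x) refl)))
                           (sym (ListP.filter-reject (x ℤ.<?_) (ℤP.<-irrefl refl))) ⟩
  below x (x ∷ xs) ++ replicate (multiplicity x (x ∷ xs)) x ++ above x (x ∷ xs) ∎
  where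
  open ≡.≡-Reasoning
  below≡[] : below x xs ≡ []
  below≡[] = ListP.filter-none (ℤ._<? x) (All.map ℤP.≤⇒≯ (≤-Linked.head-All sw))
... | tri> _ _ c<x = begin
  x ∷ xs                                        ≡⟨ sym (ListP.filter-all (c ℤ.<?_) c<w) ⟩
  [] ++ replicate 0 c ++ above c (x ∷ xs)
    ≡⟨ ++-replicate-cong c (sym (ListP.filter-none (ℤ._<? c) (All.map ℤP.<-asym c<w)))
         (cong length (sym (ListP.filter-none (ℤ._≟ c) (All.map (λ c<y → ℤP.<⇒≢ c<y ∘ sym) c<w)))) refl ⟩
  below c (x ∷ xs) ++ replicate (multiplicity c (x ∷ xs)) c ++ above c (x ∷ xs) ∎
  where
  open ≡.≡-Reasoning
  c<w : All (c ℤ.<_) (x ∷ xs)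
  c<w = c<x ∷ All.map (ℤP.<-≤-trans c<x) (≤-Linked.head-All sw)

decompose-around : ∀ c w → Around c (below c w) (above c w)
decompose-around c w = AllP.all-filter (ℤ._<? c) w , AllP.all-filter (c ℤ.<?_) w

below-sorted : ∀ c {w} → SortedMon w → SortedMon (below c w)
below-sorted c = LinkedP.filter⁺ (ℤ._<? c) ℤP.≤-trans

above-sorted : ∀ c {w} → SortedMon w → SortedMon (above c w)
above-sorted c = LinkedP.filter⁺ (c ℤ.<?_) ℤP.≤-trans

-- The coefficient of x_c^a in F, as a series in the remaining variables.
slice : ℤ → ℕ → Series → Series
slice c a F w with multiplicity c w
... | zero = F (below c w ++ replicate a c ++ above c w)
... | suc _ = 0ℚ

slice-multiplicity-0 : ∀ c a F w → multiplicity c w ≡ 0 → slice c a F w ≡ F (below c w ++ replicate a c ++ above c w)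
slice-multiplicity-0 c a F w m≡0 with multiplicity c w
slice-multiplicity-0 c a F w refl | zero = refl

slice-multiplicity-suc : ∀ c a F w {k} → multiplicity c w ≡ suc k → slice c a F w ≡ 0ℚ
slice-multiplicity-suc c a F w m≡suc with multiplicity c w
slice-multiplicity-suc c a F w refl | suc _ = refl

module _ {c lo hi} (around : Around c lo hi) (a : ℕ) (F : Series) where

  slice-around : slice c a F (lo ++ hi) ≡ F (lo ++ replicate a c ++ hi)
  slice-around = ≡.trans (slice-multiplicity-0 c a F (lo ++ hi) (multiplicity-around around 0))
                         (cong F (++-replicate-cong c (below-around around 0) refl (above-around around 0)))

  slice-around-suc : ∀ j → slice c a F (lo ++ replicate (suc j) c ++ hi) ≡ 0ℚ
  slice-around-suc j = slice-multiplicity-suc c a F (lo ++ replicate (suc j) c ++ hi) (multiplicity-around around (suc j))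

sliceTerm : ℤ → Series → ℕ → Series
sliceTerm c F a = x^ replicate a c ∙ slice c a F

sliceSum : ℤ → Series → ℕ → Series
sliceSum c F zero = sliceTerm c F 0
sliceSum c F (suc n) = sliceSum c F n +ˢ sliceTerm c F (suc n)

module _ {c lo hi} (around : Around c lo hi) (F : Series) where

  private
    w : ℕ → List ℤ
    w k = lo ++ replicate k c ++ hi

  sliceTerm-< : ∀ a k → a ℕ.< k → sliceTerm c F a (w k) ≡ 0ℚ
  sliceTerm-< a k a<k with ℕP.m≤n⇒∃[o]m+o≡n a<k
  ... | o , refl = ≡.trans (x^∙-just (replicate a c) _ (w (suc a ℕ.+ o))
                             (subst (λ n → monus (w n) (replicate a c) ≡ just (w (suc o))) (ℕP.+-suc a o)
                                    (monus-replicate around (suc o) a)))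
                           (slice-around-suc around a F o)

  sliceTerm-≡ : ∀ k → sliceTerm c F k (w k) ≡ F (w k)
  sliceTerm-≡ k = ≡.trans (x^∙-just (replicate k c) _ (w k)
                            (subst (λ n → monus (w n) (replicate k c) ≡ just (w 0)) (ℕP.+-identityʳ k)
                                   (monus-replicate around 0 k)))
                          (slice-around around k F)

  sliceTerm-> : ∀ a k → k ℕ.< a → sliceTerm c F a (w k) ≡ 0ℚ
  sliceTerm-> a k k<a = x^∙-nothing (replicate a c) _ (w k) (monus-replicate-> around k a k<a)

  sliceSum-< : ∀ k n → n ℕ.< k → sliceSum c F n (w k) ≡ 0ℚ
  sliceSum-< k zero 0<k = sliceTerm-< 0 k 0<k
  sliceSum-< k (suc n) n<k =
    ≡.trans (cong₂ ℚ._+_ (sliceSum-< k n (ℕP.<-trans (ℕP.n<1+n n) n<k)) (sliceTerm-< (suc n) k n<k)) (ℚP.+-identityˡ 0ℚ)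

  sliceSum-≥ : ∀ k n → k ℕ.≤ n → sliceSum c F n (w k) ≡ F (w k)
  sliceSum-≥ zero zero _ = sliceTerm-≡ 0
  sliceSum-≥ k (suc n) k≤1+n with k ℕP.≤? n
  ... | yes k≤n = ≡.trans (cong₂ ℚ._+_ (sliceSum-≥ k n k≤n) (sliceTerm-> (suc n) k (ℕ.s≤s k≤n))) (ℚP.+-identityʳ _)
  ... | no k≰n with ℕP.≤-antisym k≤1+n (ℕP.≰⇒> k≰n)
  ...   | refl = ≡.trans (cong₂ ℚ._+_ (sliceSum-< (suc n) n (ℕP.n<1+n n)) (sliceTerm-≡ (suc n))) (ℚP.+-identityˡ _)

length-++-replicate : ∀ lo k (c : ℤ) hi → k ℕ.≤ length (lo ++ replicate k c ++ hi)
length-++-replicate lo k c hi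
  rewrite ListP.length-++ lo {replicate k c ++ hi} | ListP.length-++ (replicate k c) {hi} | ListP.length-replicate k {c} =
  ℕP.≤-trans (ℕP.m≤m+n k (length hi)) (ℕP.m≤n+m (k ℕ.+ length hi) (length lo))

slice-decomposition : ∀ c F d → DegreeAtMost d F → F ≈ˢ sliceSum c F d
slice-decomposition c F d deg w sw = begin
  F w                    ≡⟨ cong F w≡ ⟩
  F w'                   ≡⟨ at-decomposed ⟩
  sliceSum c F d w'      ≡⟨ cong (sliceSum c F d) (sym w≡) ⟩
  sliceSum c F d w       ∎
  where
  open ≡.≡-Reasoning
  k : ℕ
  k = multiplicity c w
  w' : Monomial
  w' = below c w ++ replicate k c ++ above c w
  w≡ : w ≡ w'
  w≡ = decompose c w sw
  at-decomposed : F w' ≡ sliceSum c F d w'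
  at-decomposed with k ℕP.≤? d
  ... | yes k≤d = sym (sliceSum-≥ (decompose-around c w) F k d k≤d)
  ... | no k≰d = ≡.trans (deg w' (subst SortedMon w≡ sw) (ℕP.<-≤-trans (ℕP.≰⇒> k≰d) (length-++-replicate (below c w) k c (above c w))))
                         (sym (sliceSum-< (decompose-around c w) F k d (ℕP.≰⇒> k≰d)))

InImage : Series → Set
InImage F = ∃ λ (t : Tensor) → mult t ≈ˢ F

InImage-resp-≈ : ∀ {F G} → F ≈ˢ G → InImage F → InImage G
InImage-resp-≈ F≈G (t , t≈F) = t , λ m sm → ≡.trans (t≈F m sm) (F≈G m sm)

InImage-+ : ∀ {F G} → InImage F → InImage G → InImage (F +ˢ G)
InImage-+ (t , t≈F) (t' , t'≈G) = t ++ t' , λ m sm → ≡.trans (mult-++ t t' m) (cong₂ ℚ._+_ (t≈F m sm) (t'≈G m sm))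

InImage-0 : InImage 0ˢ
InImage-0 = [] , λ _ _ → refl

InImage-qsym : ∀ F → IsQSym F → InImage F
InImage-qsym F qsym = ((F , qsym) , (1ℚ , []) ∷ []) ∷ [] ,
  λ m _ → ≡.trans (ℚP.+-identityʳ _) (≡.trans (ℚP.+-identityʳ _) (ℚP.*-identityˡ (F m)))

x^_*ᵖ_ : Monomial → Poly → Poly
x^ u *ᵖ p = map (λ (c , v) → (c , u ++ v)) p

x^_⊗_ : Monomial → Tensor → Tensor
x^ u ⊗ t = map (λ (g , p) → (g , x^ u *ᵖ p)) t

·ᵖ-x^*ᵖ : ∀ g u p w → (g ·ᵖ (x^ u *ᵖ p)) w ≡ (x^ u ∙ (g ·ᵖ p)) w
·ᵖ-x^*ᵖ g u [] w = sym (x^∙-0 u w)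
·ᵖ-x^*ᵖ g u ((c , v) ∷ p) w = begin
  (g ·ᵖ ((c , u ++ v) ∷ x^ u *ᵖ p)) w
    ≡⟨ ·ᵖ-∷ g c (u ++ v) (x^ u *ᵖ p) w ⟩
  (g ·ᵖ ((c , u ++ v) ∷ [])) w ℚ.+ (g ·ᵖ (x^ u *ᵖ p)) w
    ≡⟨ cong₂ ℚ._+_ monomial (·ᵖ-x^*ᵖ g u p w) ⟩
  (x^ u ∙ (g ·ᵖ ((c , v) ∷ []))) w ℚ.+ (x^ u ∙ (g ·ᵖ p)) w
    ≡⟨ sym (x^∙-+ u (g ·ᵖ ((c , v) ∷ [])) (g ·ᵖ p) w) ⟩
  (x^ u ∙ ((g ·ᵖ ((c , v) ∷ [])) +ˢ (g ·ᵖ p))) w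
    ≡⟨ x^∙-cong u w (λ r → sym (·ᵖ-∷ g c v p r)) ⟩
  (x^ u ∙ (g ·ᵖ ((c , v) ∷ p))) w ∎
  where
  open ≡.≡-Reasoning
  monomial : (g ·ᵖ ((c , u ++ v) ∷ [])) w ≡ (x^ u ∙ (g ·ᵖ ((c , v) ∷ []))) w
  monomial rewrite monus-++ʳ w u v with monus w u
  ... | nothing = refl
  ... | just r with monus r v
  ...   | just _ = refl
  ...   | nothing = refl

mult-x^⊗ : ∀ u t w → mult (x^ u ⊗ t) w ≡ (x^ u ∙ mult t) w
mult-x^⊗ u [] w = sym (x^∙-0 u w)
mult-x^⊗ u ((g , p) ∷ t) w =
  ≡.trans (cong₂ ℚ._+_ (·ᵖ-x^*ᵖ (proj₁ g) u p w) (mult-x^⊗ u t w)) (sym (x^∙-+ u (proj₁ g ·ᵖ p) (mult t) w))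

InImage-x^∙ : ∀ u {h} → InImage h → InImage (x^ u ∙ h)
InImage-x^∙ u {h} (t , t≈h) = x^ u ⊗ t , λ w sw → ≡.trans (mult-x^⊗ u t w) (x^∙-≈ w sw)
  where
  x^∙-≈ : ∀ w → SortedMon w → (x^ u ∙ mult t) w ≡ (x^ u ∙ h) w
  x^∙-≈ w sw with monus w u in e
  ... | just r = t≈h r (monus-sorted w u sw e)
  ... | nothing = refl

InImage-sliceSum : ∀ c F n → (∀ a → a ℕ.≤ n → InImage (slice c a F)) → InImage (sliceSum c F n)
InImage-sliceSum c F zero slices = InImage-x^∙ [] (slices 0 ℕ.z≤n)
InImage-sliceSum c F (suc n) slices =
  InImage-+ (InImage-sliceSum c F n (λ a a≤n → slices a (ℕP.m≤n⇒m≤1+n a≤n)))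
            (InImage-x^∙ (replicate (suc n) c) (slices (suc n) ℕP.≤-refl))

InImage-slices : ∀ c F d → DegreeAtMost d F → (∀ a → a ℕ.≤ d → InImage (slice c a F)) → InImage F
InImage-slices c F d deg slices =
  InImage-resp-≈ (λ m sm → sym (slice-decomposition c F d deg m sm)) (InImage-sliceSum c F d slices)

multiplicity-0⇒∉ : ∀ c w → multiplicity c w ≡ 0 → c ∉ w
multiplicity-0⇒∉ c w m≡0 c∈w with filter (ℤ._≟ c) w | ∈-filter⁺ (ℤ._≟ c) c∈w refl
multiplicity-0⇒∉ c w () c∈w | _ ∷ _ | _

sliced-sorted : ∀ c a {w} → SortedMon w → SortedMon (below c w ++ replicate a c ++ above c w)
sliced-sorted c a {w} sw = around-sorted (decompose-around c w) a (below-sorted c sw) (above-sorted c sw)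

length-sliced : ∀ c a w → SortedMon w → multiplicity c w ≡ 0 →
                length (below c w ++ replicate a c ++ above c w) ≡ a ℕ.+ length w
length-sliced c a w sw m≡0 = begin
  length (lo ++ replicate a c ++ hi)            ≡⟨ ListP.length-++ lo ⟩
  length lo ℕ.+ length (replicate a c ++ hi)    ≡⟨ cong (length lo ℕ.+_) (ListP.length-++ (replicate a c)) ⟩
  length lo ℕ.+ (length (replicate a c) ℕ.+ length hi)
    ≡⟨ cong (λ n → length lo ℕ.+ (n ℕ.+ length hi)) (ListP.length-replicate a) ⟩
  length lo ℕ.+ (a ℕ.+ length hi)               ≡⟨ ℕP.+-comm (length lo) _ ⟩
  (a ℕ.+ length hi) ℕ.+ length lo               ≡⟨ ℕP.+-assoc a (length hi) (length lo) ⟩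
  a ℕ.+ (length hi ℕ.+ length lo)               ≡⟨ cong (a ℕ.+_) (≡.trans (ℕP.+-comm (length hi) (length lo)) (sym (ListP.length-++ lo))) ⟩
  a ℕ.+ length (lo ++ hi)                       ≡⟨ cong (λ w → a ℕ.+ length w) (sym w≡lo++hi) ⟩
  a ℕ.+ length w                                ∎
  where
  open ≡.≡-Reasoning
  lo hi : List ℤ
  lo = below c w
  hi = above c w
  w≡lo++hi : w ≡ lo ++ hi
  w≡lo++hi = ≡.trans (decompose c w sw) (cong (λ k → lo ++ replicate k c ++ hi) m≡0)

slice-degree : ∀ c a {d} F → DegreeAtMost (a ℕ.+ d) F → DegreeAtMost d (slice c a F)
slice-degree c a {d} F deg w sw d<|w| with multiplicity c w in m≡0
... | suc _ = refl
... | zero = deg _ (sliced-sorted c a sw)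
                 (subst (a ℕ.+ d ℕ.<_) (sym (length-sliced c a w sw m≡0)) (ℕP.+-monoʳ-< a d<|w|))

slice-vanishesAbove : ∀ c a {N} F → c ℤ.≤ N → VanishesAbove N F → VanishesAbove N (slice c a F)
slice-vanishesAbove c a F c≤N vanish w sw N<w with multiplicity c w
... | suc _ = refl
... | zero with find N<w
...   | j , j∈w , N<j = vanish _ (sliced-sorted c a sw)
          (lose (∈-++⁺ʳ (below c w) (∈-++⁺ʳ (replicate a c) (∈-filter⁺ (c ℤ.<?_) j∈w (ℤP.≤-<-trans c≤N N<j)))) N<j)

slice-vanishesAbove-suc : ∀ a {N} F → VanishesAbove (ℤ.suc N) F → VanishesAbove N (slice (ℤ.suc N) a F)
slice-vanishesAbove-suc a {N} F vanish w sw N<w with multiplicity (ℤ.suc N) w in m≡0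
... | suc _ = refl
... | zero with find N<w
...   | j , j∈w , N<j = vanish _ (sliced-sorted c a sw)
          (lose (∈-++⁺ʳ (below c w) (∈-++⁺ʳ (replicate a c) (∈-filter⁺ (c ℤ.<?_) j∈w c<j))) c<j)
  where
  c : ℤ
  c = ℤ.suc N
  c<j : c ℤ.< j
  c<j = ℤP.≤∧≢⇒< (ℤP.i<j⇒suc[i]≤j N<j) (λ c≡j → multiplicity-0⇒∉ c w m≡0 (subst (_∈ w) (sym c≡j) j∈w))

module _ {c S} (S<c : All (ℤ._< c) S) (m : List ℤ) where

  multiplicity-++ˡ : multiplicity c (S ++ m) ≡ multiplicity c m
  multiplicity-++ˡ = cong length (≡.trans (ListP.filter-++ (ℤ._≟ c) S m)
                                         (cong (_++ _) (ListP.filter-none (ℤ._≟ c) (All.map ℤP.<⇒≢ S<c))))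

  below-++ˡ : below c (S ++ m) ≡ S ++ below c m
  below-++ˡ = ≡.trans (ListP.filter-++ (ℤ._<? c) S m) (cong (_++ below c m) (ListP.filter-all (ℤ._<? c) S<c))

  above-++ˡ : above c (S ++ m) ≡ above c m
  above-++ˡ = ≡.trans (ListP.filter-++ (c ℤ.<?_) S m) (cong (_++ above c m) (ListP.filter-none (c ℤ.<?_) (All.map ℤP.<-asym S<c)))

slice-++ˡ : ∀ c a F S m → All (ℤ._< c) S → slice c a F (S ++ m) ≡ slice c a (λ T → F (S ++ T)) m
slice-++ˡ c a F S m S<c with multiplicity c m in m≡
... | suc _ = slice-multiplicity-suc c a F (S ++ m) (≡.trans (multiplicity-++ˡ S<c m) m≡)
... | zero = ≡.trans (slice-multiplicity-0 c a F (S ++ m) (≡.trans (multiplicity-++ˡ S<c m) m≡)) (cong F (begin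
  below c (S ++ m) ++ replicate a c ++ above c (S ++ m)
    ≡⟨ ++-replicate-cong c (below-++ˡ S<c m) refl (above-++ˡ S<c m) ⟩
  (S ++ below c m) ++ replicate a c ++ above c m
    ≡⟨ ListP.++-assoc S (below c m) _ ⟩
  S ++ below c m ++ replicate a c ++ above c m ∎))
  where open ≡.≡-Reasoning

slice-cong : ∀ c a {b} {G G' : Series} → b ℤ.< c →
             (∀ T → SortedMon T → All (b ℤ.<_) T → G T ≡ G' T) →
             ∀ m → SortedMon m → All (b ℤ.<_) m → slice c a G m ≡ slice c a G' m
slice-cong c a b<c G≗G' m sm b<m with multiplicity c m
... | suc _ = refl
... | zero = G≗G' _ (sliced-sorted c a sm)
               (AllP.++⁺ (AllP.filter⁺ (ℤ._<? c) b<m) (AllP.++⁺ (AllP.replicate⁺ a b<c) (AllP.filter⁺ (c ℤ.<?_) b<m)))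

slice-backQuasisymmetricAt : ∀ c a {b F} → b ℤ.< c → BackQuasisymmetricAt b F → BackQuasisymmetricAt b (slice c a F)
slice-backQuasisymmetricAt c a {b} {F} b<c bq k as is js si sj is≤b js≤b m sm b<m = begin
  slice c a F (expand is as ++ m)                  ≡⟨ slice-++ˡ c a F (expand is as) m (expand-< is is≤b) ⟩
  slice c a (λ T → F (expand is as ++ T)) m
    ≡⟨ slice-cong c a b<c (bq k as is js si sj is≤b js≤b) m sm b<m ⟩
  slice c a (λ T → F (expand js as ++ T)) m        ≡⟨ sym (slice-++ˡ c a F (expand js as) m (expand-< js js≤b)) ⟩
  slice c a F (expand js as ++ m)                  ∎
  where
  open ≡.≡-Reasoning
  expand-< : ∀ xs → All (ℤ._≤ b) (toList xs) → All (ℤ._< c) (expand xs as)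
  expand-< xs xs≤b = expand-All xs as (All.map (λ x≤b → ℤP.≤-<-trans x≤b b<c) xs≤b)

shiftDown : ℤ → ℤ → ℤ
shiftDown c i with i ℤ.≤? c
... | yes _ = ℤ.pred i
... | no _ = i

shiftDown-≤ : ∀ c {i} → i ℤ.≤ c → shiftDown c i ≡ ℤ.pred i
shiftDown-≤ c {i} i≤c with i ℤ.≤? c
... | yes _ = refl
... | no i≰c = ⊥-elim (i≰c i≤c)

shiftDown-> : ∀ c {i} → c ℤ.< i → shiftDown c i ≡ i
shiftDown-> c {i} c<i with i ℤ.≤? c
... | yes i≤c = ⊥-elim (ℤP.<⇒≱ c<i i≤c)
... | no _ = refl

shiftDown-< : ∀ c {i j} → i ℤ.< j → shiftDown c i ℤ.< shiftDown c j
shiftDown-< c {i} {j} i<j with i ℤ.≤? c | j ℤ.≤? c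
... | yes _ | yes _ = ℤP.+-monoʳ-< ℤ.-1ℤ i<j
... | yes i≤c | no j≰c = ℤP.≤-<-trans (ℤP.i≤j⇒pred[i]≤j i≤c) (ℤP.≰⇒> j≰c)
... | no i≰c | yes j≤c = ⊥-elim (ℤP.<⇒≱ (ℤP.<-trans (ℤP.≰⇒> i≰c) i<j) j≤c)
... | no _ | no _ = i<j

shiftDown-mono-≤ : ∀ c {i j} → i ℤ.≤ j → shiftDown c i ℤ.≤ shiftDown c j
shiftDown-mono-≤ c {i} {j} i≤j with i ℤ.≟ j
... | yes refl = ℤP.≤-refl
... | no i≢j = ℤP.<⇒≤ (shiftDown-< c (ℤP.≤∧≢⇒< i≤j i≢j))

shiftDown-≤-pred : ∀ c {i} → i ℤ.≤ c → shiftDown c i ℤ.≤ ℤ.pred c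
shiftDown-≤-pred c i≤c rewrite shiftDown-≤ c i≤c = ℤP.pred-mono i≤c

map-shiftDown-expand : ∀ c {k} (is : Vec ℤ k) (as : Vec ℕ k) {m} → All (c ℤ.<_) m →
                       map (shiftDown c) (expand is as ++ m) ≡ expand (Vec.map (shiftDown c) is) as ++ m
map-shiftDown-expand c is as {m} c<m =
  ≡.trans (ListP.map-++ (shiftDown c) (expand is as) m) (cong₂ _++_ (expand-map (shiftDown c) is as) (fixes c<m))
  where
  fixes : ∀ {m} → All (c ℤ.<_) m → map (shiftDown c) m ≡ m
  fixes [] = refl
  fixes (c<x ∷ c<m) = cong₂ _∷_ (shiftDown-> c c<x) (fixes c<m)

shifted : ℤ → Series → Series
shifted c F w = F (map (shiftDown c) w)

shifted-sorted : ∀ c {w} → SortedMon w → SortedMon (map (shiftDown c) w)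
shifted-sorted c sw = LinkedP.map⁺ (Linked.map (shiftDown-mono-≤ c) sw)

shifted-degree : ∀ c {d} F → DegreeAtMost d F → DegreeAtMost d (shifted c F)
shifted-degree c {d} F deg w sw d<|w| =
  deg _ (shifted-sorted c sw) (subst (d ℕ.<_) (sym (ListP.length-map (shiftDown c) w)) d<|w|)

shifted-vanishesAbove : ∀ c {N} F → c ℤ.≤ N → VanishesAbove N F → VanishesAbove N (shifted c F)
shifted-vanishesAbove c F c≤N vanish w sw N<w with find N<w
... | j , j∈w , N<j =
  vanish _ (shifted-sorted c sw) (lose (∈-map⁺ (shiftDown c) j∈w) (subst (_ ℤ.<_) (sym (shiftDown-> c (ℤP.≤-<-trans c≤N N<j))) N<j))

shifted-backQuasisymmetricAt : ∀ c F → BackQuasisymmetricAt (ℤ.pred c) F → BackQuasisymmetricAt c (shifted c F)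
shifted-backQuasisymmetricAt c F bq k as is js si sj is≤c js≤c m sm c<m = begin
  F (map (shiftDown c) (expand is as ++ m))            ≡⟨ cong F (map-shiftDown-expand c is as c<m) ⟩
  F (expand (Vec.map (shiftDown c) is) as ++ m)
    ≡⟨ bq k as _ _ (strictlySorted-map (shiftDown c) (shiftDown-< c) is si) (strictlySorted-map (shiftDown c) (shiftDown-< c) js sj)
          (All-toList-map (shiftDown c) (shiftDown-≤-pred c) is is≤c) (All-toList-map (shiftDown c) (shiftDown-≤-pred c) js js≤c)
          m sm (All.map (ℤP.<-trans (ℤP.i≤pred[j]⇒i<j ℤP.≤-refl)) c<m) ⟩
  F (expand (Vec.map (shiftDown c) js) as ++ m)        ≡⟨ cong F (sym (map-shiftDown-expand c js as c<m)) ⟩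
  F (map (shiftDown c) (expand js as ++ m))            ∎
  where open ≡.≡-Reasoning

_-ˢ_ : Series → Series → Series
F -ˢ G = F +ˢ ((ℚ.- 1ℚ) •ˢ G)

-ˢ-zero : ∀ {F G : Series} {m} → F m ≡ 0ℚ → G m ≡ 0ℚ → (F -ˢ G) m ≡ 0ℚ
-ˢ-zero F≡0 G≡0 = cong₂ (λ x y → x ℚ.+ ℚ.- 1ℚ ℚ.* y) F≡0 G≡0

-- F and its shift agree off x_c, by back quasisymmetry at pred c.
slice-0-shifted-difference : ∀ c F → BackQuasisymmetricAt (ℤ.pred c) F →
                             ∀ w → SortedMon w → slice c 0 (F -ˢ shifted c F) w ≡ 0ℚ
slice-0-shifted-difference c F bq w sw with multiplicity c w
... | suc _ = refl
... | zero = ≡.trans (cong (λ x → F (lo ++ hi) ℚ.+ ℚ.- 1ℚ ℚ.* x) shifted≡)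
                     (≡.trans (ℚP.+-comm (F (lo ++ hi)) _) (-1*x+x≡0 (F (lo ++ hi))))
  where
  open ≡.≡-Reasoning
  lo hi : List ℤ
  lo = below c w
  hi = above c w
  open ExponentVector (exponentVector lo (below-sorted c sw))
  lo<c : All (ℤ._< c) lo
  lo<c = AllP.all-filter (ℤ._<? c) w
  c<hi : All (c ℤ.<_) hi
  c<hi = AllP.all-filter (c ℤ.<?_) w
  shifted≡ : F (map (shiftDown c) (lo ++ hi)) ≡ F (lo ++ hi)
  shifted≡ = begin
    F (map (shiftDown c) (lo ++ hi))                 ≡⟨ cong (λ l → F (map (shiftDown c) (l ++ hi))) (sym expand≡) ⟩
    F (map (shiftDown c) (expand is as ++ hi))       ≡⟨ cong F (map-shiftDown-expand c is as c<hi) ⟩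
    F (expand (Vec.map (shiftDown c) is) as ++ hi)
      ≡⟨ bq _ as _ is (strictlySorted-map (shiftDown c) (shiftDown-< c) is increasing) increasing
            (All-toList-map (shiftDown c) (shiftDown-≤-pred c ∘ ℤP.<⇒≤) is (All⁺ lo<c)) (All⁺ (All.map ℤP.i<j⇒i≤pred[j] lo<c))
            hi (above-sorted c sw) (All.map (ℤP.<-trans (ℤP.i≤pred[j]⇒i<j ℤP.≤-refl)) c<hi) ⟩
    F (expand is as ++ hi)                           ≡⟨ cong (λ l → F (l ++ hi)) expand≡ ⟩
    F (lo ++ hi)                                     ∎

-- QR← lies in the image

vanishesAbove-mono : ∀ {N N' F} → N ℤ.≤ N' → VanishesAbove N F → VanishesAbove N' F
vanishesAbove-mono N≤N' vanish m sm N'<m = vanish m sm (Any.map (ℤP.≤-<-trans N≤N') N'<m)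

≤+∣_∣ : ∀ i → i ℤ.≤ ℤ.+ ℤ.∣ i ∣
≤+∣ ℤ.+ n ∣ = ℤP.≤-refl
≤+∣ ℤ.-[1+ n ] ∣ = ℤ.-≤+

-∣_∣≤ : ∀ i → ℤ.- ℤ.+ ℤ.∣ i ∣ ℤ.≤ i
-∣ ℤ.+ zero ∣≤ = ℤP.≤-refl
-∣ ℤ.+ suc n ∣≤ = ℤ.-≤+
-∣ ℤ.-[1+ n ] ∣≤ = ℤP.≤-refl

pred-neg : ∀ p → ℤ.pred (ℤ.- ℤ.+ p) ≡ ℤ.- ℤ.+ suc p
pred-neg zero = refl
pred-neg (suc p) = refl

y+[x-y]≡x : ∀ x y → y ℚ.+ (x ℚ.+ ℚ.- 1ℚ ℚ.* y) ≡ x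
y+[x-y]≡x = solve 2 (λ x y → y :+ (x :+ con (ℚ.- 1ℚ) :* y) := x) refl
  where open +-*-Solver

InImageOfDegree : ℕ → Set
InImageOfDegree d = ∀ p q F → DegreeAtMost d F → VanishesAbove (ℤ.+ q) F →
                    BackQuasisymmetricAt (ℤ.- ℤ.+ p) F → InImage F

module _ {d : ℕ} (smaller : ∀ {d'} → d' ℕ.< d → InImageOfDegree d') where

  private
    higherSlice : ∀ {c F} p q a → suc a ℕ.≤ d → DegreeAtMost d F → VanishesAbove (ℤ.+ q) (slice c (suc a) F) →
                  ℤ.- ℤ.+ p ℤ.< c → BackQuasisymmetricAt (ℤ.- ℤ.+ p) F → InImage (slice c (suc a) F)
    higherSlice {c} {F} p q a a<d deg vanish b<c bq =
      smaller (ℕP.∸-monoʳ-< ℕ.z<s a<d) p q _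
        (slice-degree c (suc a) F (subst (λ n → DegreeAtMost n F) (sym (ℕP.m+[n∸m]≡n a<d)) deg))
        vanish (slice-backQuasisymmetricAt c (suc a) b<c bq)

  -- Induction on q, slicing along x_{q+1}, beyond which F vanishes.
  inImage-threshold-0 : ∀ q F → DegreeAtMost d F → VanishesAbove (ℤ.+ q) F →
                        BackQuasisymmetricAt ℤ.0ℤ F → InImage F
  inImage-threshold-0 zero F deg vanish bq = InImage-qsym F ((d , deg) , vanish , quasisymmetric)
    where
    quasisymmetric : ∀ k (as : Vec ℕ k) (is js : Vec ℤ k) → StrictlyIncreasing is → StrictlyIncreasing js →
                     All (ℤ._≤ ℤ.0ℤ) (toList is) → All (ℤ._≤ ℤ.0ℤ) (toList js) → F (expand is as) ≡ F (expand js as)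
    quasisymmetric k as is js si sj is≤0 js≤0 =
      subst₂ (λ u v → F u ≡ F v) (ListP.++-identityʳ (expand is as)) (ListP.++-identityʳ (expand js as))
             (bq k as is js si sj is≤0 js≤0 [] [] [])
      where open ≡ using (subst₂)
  inImage-threshold-0 (suc q) F deg vanish bq = InImage-slices c F d deg slices
    where
    c : ℤ
    c = ℤ.+ suc q
    0<c : ℤ.0ℤ ℤ.< c
    0<c = ℤ.+<+ ℕ.z<s
    slices : ∀ a → a ℕ.≤ d → InImage (slice c a F)
    slices zero _ = inImage-threshold-0 q (slice c 0 F) (slice-degree c 0 F deg) (slice-vanishesAbove-suc 0 F vanish)
                                        (slice-backQuasisymmetricAt c 0 0<c bq)
    slices (suc a) a<d = higherSlice 0 q a a<d deg (slice-vanishesAbove-suc (suc a) F vanish) 0<c bq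

  -- Induction on p: F = F' + (F - F') with F' the shift of F at c = -p, which is back quasisymmetric at c,
  -- while F - F' has no slice free of x_c.
  inImageOfDegree : InImageOfDegree d
  inImageOfDegree zero = inImage-threshold-0
  inImageOfDegree (suc p) q F deg vanish bq =
    InImage-resp-≈ (λ w _ → y+[x-y]≡x (F w) (F' w))
      (InImage-+ (inImageOfDegree p q F' (shifted-degree c F deg) vanish' bq')
                 (InImage-slices c G d degG slicesG))
    where
    c b : ℤ
    c = ℤ.- ℤ.+ p
    b = ℤ.- ℤ.+ suc p
    b<c : b ℤ.< c
    b<c = ℤP.neg-mono-< (ℤ.+<+ (ℕP.n<1+n p))
    c≤q : c ℤ.≤ ℤ.+ q
    c≤q = ℤP.neg-≤-pos
    F' G : Series
    F' = shifted c F
    G = F -ˢ F'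
    bq-pred : BackQuasisymmetricAt (ℤ.pred c) F
    bq-pred = backQuasisymmetricAt-mono {F = F} (ℤP.≤-reflexive (pred-neg p)) bq
    vanish' : VanishesAbove (ℤ.+ q) F'
    vanish' = shifted-vanishesAbove c F c≤q vanish
    bq' : BackQuasisymmetricAt c F'
    bq' = shifted-backQuasisymmetricAt c F bq-pred
    degG : DegreeAtMost d G
    degG m sm lt = -ˢ-zero {F} {F'} (deg m sm lt) (shifted-degree c F deg m sm lt)
    vanishG : VanishesAbove (ℤ.+ q) G
    vanishG m sm q<m = -ˢ-zero {F} {F'} (vanish m sm q<m) (vanish' m sm q<m)
    bqG : BackQuasisymmetricAt b G
    bqG k as is js si sj is≤b js≤b m sm b<m =
      cong₂ (λ x y → x ℚ.+ ℚ.- 1ℚ ℚ.* y) (bq k as is js si sj is≤b js≤b m sm b<m)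
            (backQuasisymmetricAt-mono {F = F'} (ℤP.<⇒≤ b<c) bq' k as is js si sj is≤b js≤b m sm b<m)
    slicesG : ∀ a → a ℕ.≤ d → InImage (slice c a G)
    slicesG zero _ = InImage-resp-≈ (λ w sw → sym (slice-0-shifted-difference c F bq-pred w sw)) InImage-0
    slicesG (suc a) a<d = higherSlice (suc p) q a a<d degG (slice-vanishesAbove c (suc a) G c≤q vanishG) b<c bqG

InBackQR⇒InImage : ∀ f → InBackQR f → InImage f
InBackQR⇒InImage f (((d , deg) , (N , vanish)) , (b , bq)) =
  <-rec InImageOfDegree (λ _ smaller → inImageOfDegree smaller) d ℤ.∣ b ∣ ℤ.∣ N ∣ f deg
    (vanishesAbove-mono {F = f} ≤+∣ N ∣ vanish) (backQuasisymmetricAt-mono {F = f} -∣ b ∣≤ bq)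

proposition4p4 : (∀ (t t' : Tensor) → mult t ≈ˢ mult t' → t ∼ t') ×
    (∀ (f : Series) → InBackQR f ⇔ (∃ λ (t : Tensor) → mult t ≈ˢ f))
proposition4p4 =
  mult-injective ,
  λ f → mk⇔ (InBackQR⇒InImage f) (λ (t , t≈f) → InBackQR-resp-≈ t≈f (mult-InBackQR t))
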